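{- For each $m \ge 3$ there exist infinitely many finite connected graphs $\Gamma$ with a group of automorphisms $G$ such that (i) $\Gamma$ is $(G,2)$-arc-transitive, (ii) $(\Gamma,G)$ is locally-$S_m$, (iii) $\Gamma$ contains a $G$-permutable $m$-matching, and (iv) $G$ has a nontrivial normal subgroup $N$ with more than two orbits on $V(\Gamma)$, yet the normal quotient graph $\Gamma_N$ does not contain a $G$-permutable $m$-matching.
   Context: An $s$-arc is a sequence $(\alpha_0,\dots,\alpha_s)$ of vertices with consecutive ones adjacent and $\alpha_{j-1}\neq\alpha_{j+1}$; $(G,2)$-arc-transitive means $G$ is transitive on $2$-arcs. $(\Gamma,G)$ is locally-$S_m$ if $G$ is vertex-transitive and the action of a vertex stabilizer $G_\alpha$ on the neighbours of $\alpha$ is permutation isomorphic to the natural action of $S_m$. A matching $\mathcal{M}$ with $m$ edges is $G$-permutable if the setwise stabilizer $G_{\mathcal{M}}$ induces $S_m$ on the edges of $\mathcal{M}$. The normal quotient $\Gamma_N$ has as vertices the $N$-orbits on $V(\Gamma)$, two orbits adjacent iff some vertex of one is adjacent in $\Gamma$ to some vertex of the other; $G$ acts on $\Gamma_N$ through its action on $N$-orbits. -}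

module Defs where

open import Data.Nat using (ℕ)
open import Data.Fin using (Fin)
open import Data.Fin.Permutation using (Permutation′; _⟨$⟩ʳ_)
open import Data.Bool using (Bool; true)
open import Data.Product using (Σ; ∃; ∃-syntax; _×_; _,_)
open import Data.Sum using (_⊎_)
open import Function using (_∘_; id)
open import Relation.Binary.PropositionalEquality using (_≡_; _≢_)
open import Relation.Nullary using (¬_)

record Graph (n : ℕ) : Set where
  field
    adj   : Fin n → Fin n → Bool
    sym   : ∀ x y → adj x y ≡ adj y x
    irrefl : ∀ x → ¬ (adj x x ≡ true)

open Graph public

Edge : ∀ {n} → Graph n → Fin n → Fin n → Set
Edge Γ x y = adj Γ x y ≡ true

data Reach {n} (Γ : Graph n) : Fin n → Fin n → Set where
  here  : ∀ {x} → Reach Γ x x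
  step  : ∀ {x y z} → Edge Γ x y → Reach Γ y z → Reach Γ x z

Connected : ∀ {n} → Graph n → Set
Connected Γ = ∀ x y → Reach Γ x y

Perm : ℕ → Set
Perm n = Fin n → Fin n

IsInverse : ∀ {n} → Perm n → Perm n → Set
IsInverse g h = (∀ x → h (g x) ≡ x) × (∀ x → g (h x) ≡ x)

record IsPermGroup {n} (G : Perm n → Set) : Set where
  field
    id∈  : G id
    comp∈ : ∀ {g h} → G g → G h → G (g ∘ h)
    inv∈ : ∀ {g} → G g → Σ (Perm n) λ h → G h × IsInverse g h

record IsAutGroup {n} (Γ : Graph n) (G : Perm n → Set) : Set where
  field
    isGroup : IsPermGroup G
    preserves : ∀ {g} → G g → ∀ x y → adj Γ (g x) (g y) ≡ adj Γ x y

record IsNormalSubgroup {n} (G N : Perm n → Set) : Set where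
  field
    isGroup : IsPermGroup N
    sub     : ∀ {h} → N h → G h
    normal  : ∀ {g h g'} → G g → N h → IsInverse g g' → N (g ∘ h ∘ g')

Nontrivial : ∀ {n} → (Perm n → Set) → Set
Nontrivial N = ∃[ h ] (N h × ∃[ x ] (h x ≢ x))

VertexTransitive : ∀ {n} → (Perm n → Set) → Set
VertexTransitive G = ∀ x y → ∃[ g ] (G g × g x ≡ y)

Is2Arc : ∀ {n} → Graph n → Fin n → Fin n → Fin n → Set
Is2Arc Γ a₀ a₁ a₂ = Edge Γ a₀ a₁ × Edge Γ a₁ a₂ × a₀ ≢ a₂

TwoArcTransitive : ∀ {n} → Graph n → (Perm n → Set) → Set
TwoArcTransitive Γ G =
  ∀ a₀ a₁ a₂ b₀ b₁ b₂ → Is2Arc Γ a₀ a₁ a₂ → Is2Arc Γ b₀ b₁ b₂ →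
  ∃[ g ] (G g × g a₀ ≡ b₀ × g a₁ ≡ b₁ × g a₂ ≡ b₂)

-- (Γ,G) locally-S_m: G vertex-transitive, and for each vertex α the
-- action of G_α on Γ(α) is permutation isomorphic to the natural action
-- of S_m, i.e. there is a bijection e : Fin m → Γ(α) under which the
-- permutation group induced by G_α on Γ(α) is exactly Sym(Fin m).
-- (Induced permutations automatically lie in e Sym(m) e⁻¹, so this says
-- every π ∈ S_m is induced by some g ∈ G_α.)
LocallySym : ∀ {n} → ℕ → Graph n → (Perm n → Set) → Set
LocallySym {n} m Γ G =
  VertexTransitive G ×
  (∀ α → Σ (Fin m → Fin n) λ e →
      (∀ i j → e i ≡ e j → i ≡ j) ×
      (∀ β → Edge Γ α β → ∃[ i ] (e i ≡ β)) ×
      (∀ i → Edge Γ α (e i)) ×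
      (∀ (π : Permutation′ m) →
         ∃[ g ] (G g × g α ≡ α × (∀ i → g (e i) ≡ e (π ⟨$⟩ʳ i)))))

PairEq : ∀ {A : Set} → (A → A → Set) → A → A → A → A → Set
PairEq R x y x' y' = (R x x' × R y y') ⊎ (R x y' × R y x')

record Matching {n} (m : ℕ) (Γ : Graph n) : Set where
  field
    u v    : Fin m → Fin n
    isEdge : ∀ i → Edge Γ (u i) (v i)
    uu     : ∀ i j → u i ≡ u j → i ≡ j
    vv     : ∀ i j → v i ≡ v j → i ≡ j
    uv     : ∀ i j → u i ≢ v j

open Matching public

-- G-permutable: the setwise stabiliser G_M induces S_m on the edges of M,
-- i.e. every permutation π of the m edges is induced by some g ∈ G
-- (such g maps M to itself, hence lies in G_M).
Permutable : ∀ {n m} {Γ : Graph n} → (Perm n → Set) → Matching m Γ → Set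
Permutable {m = m} G M =
  ∀ (π : Permutation′ m) → ∃[ g ] (G g ×
     (∀ i → PairEq _≡_ (g (u M i)) (g (v M i))
                      (u M (π ⟨$⟩ʳ i)) (v M (π ⟨$⟩ʳ i))))

-- Normal quotients.  Vertices of Γ_N are N-orbits; an orbit is
-- represented by any of its vertices, with equality "same N-orbit".

SameOrbit : ∀ {n} → (Perm n → Set) → Fin n → Fin n → Set
SameOrbit N x y = ∃[ h ] (N h × h x ≡ y)

QEdge : ∀ {n} → Graph n → (Perm n → Set) → Fin n → Fin n → Set
QEdge Γ N x y = ¬ SameOrbit N x y ×
  ∃[ x' ] ∃[ y' ] (SameOrbit N x x' × SameOrbit N y y' × Edge Γ x' y')

MoreThanTwoOrbits : ∀ {n} → (Perm n → Set) → Set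
MoreThanTwoOrbits N = ∃[ x ] ∃[ y ] ∃[ z ]
  (¬ SameOrbit N x y × ¬ SameOrbit N x z × ¬ SameOrbit N y z)

record QMatching {n} (m : ℕ) (Γ : Graph n) (N : Perm n → Set) : Set where
  field
    qu qv   : Fin m → Fin n
    qisEdge : ∀ i → QEdge Γ N (qu i) (qv i)
    quu     : ∀ i j → SameOrbit N (qu i) (qu j) → i ≡ j
    qvv     : ∀ i j → SameOrbit N (qv i) (qv j) → i ≡ j
    quv     : ∀ i j → ¬ SameOrbit N (qu i) (qv j)

open QMatching public

QPermutable : ∀ {n m} {Γ : Graph n} {N : Perm n → Set} →
              (Perm n → Set) → QMatching m Γ N → Set
QPermutable {m = m} {N = N} G M =
  ∀ (π : Permutation′ m) → ∃[ g ] (G g ×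
     (∀ i → PairEq (SameOrbit N) (g (qu M i)) (g (qv M i))
                      (qu M (π ⟨$⟩ʳ i)) (qv M (π ⟨$⟩ʳ i))))

module Submission where

-- Γ is the Z_r-homology cover of K_{m+1}: a vertex over i is a Z_r-chain x on
-- K_{m+1} with ∂x = [0] − [i], and (i, x) ~ (j, x + [i,j]); it has (m+1)·r^(m(m−1)/2)
-- vertices, and r ≥ 2 is arbitrary.  G is the group of automorphisms permuting the fibres, N the subgroup
-- fixing each fibre.  N contains the translations by cycles, which act transitively
-- on each fibre, and G contains a lift of every permutation of K_{m+1}; the lifts
-- fixing 0 act on the neighbours of the base vertex as S_m, which gives local S_m
-- action and 2-arc-transitivity.  The triangles 0 → a → b → 0 span the cycle space
-- and are closed walks from the base vertex, so Γ is connected.  With the fans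
-- F_i = Σ_a [0 → i → a → 0], the edges {F_i, F_i + [0,i]} form an m-matching that
-- the same lifts permute as S_m.  But the N-orbits are the m + 1 fibres, too few to
-- carry the 2m distinct endpoints of an m-matching of Γ_N.

open import Data.Nat using (ℕ; zero; suc; _+_; _*_; _^_; _≤_; _<_; s≤s; z≤n)
import Data.Nat.Properties as ℕ
open import Data.Nat.DivMod using (_%_; m%n<n; m<n⇒m%n≡m; %-distribˡ-+; %-distribˡ-*; [m+kn]%n≡m%n)
open import Data.Nat.Tactic.RingSolver using (solve-∀)
open import Data.Fin using (Fin; zero; suc; toℕ; fromℕ<; combine; remQuot; splitAt; join)
open import Data.Fin.Properties
  using (suc-injective; toℕ-fromℕ<; fromℕ<-cong; toℕ-injective; toℕ<n;
         combine-remQuot; combine-injective; all?; injective⇒≤; join-splitAt)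
  renaming (_≟_ to _≟F_)
open import Data.Fin.Permutation
  using (Permutation′; _⟨$⟩ʳ_; _⟨$⟩ˡ_; inverseˡ; inverseʳ; flip; transpose; lift₀; _∘ₚ_)
import Data.Fin.Permutation.Components as PC
open import Data.Bool using (true)
open import Data.Product using (Σ; ∃; ∃-syntax; _×_; _,_; proj₁; proj₂)
open import Data.Sum using (_⊎_; inj₁; inj₂)
open import Data.Empty using (⊥-elim)
open import Function using (_∘_; id)
open import Relation.Binary.PropositionalEquality
open import Relation.Nullary using (¬_; yes; no; Dec; does)
open import Relation.Nullary.Decidable using (map′; _×-dec_; ¬?; dec-true; does-⇔)
open import Algebra.Properties.CommutativeMonoid.Sum ℕ.+-0-commutativeMonoid
  using (sum; ∑-distrib-+; ∑-comm; sum-permute; sum-cong-≗)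
open import Algebra.Properties.Semiring.Sum ℕ.+-*-semiring using (*-distribˡ-sum)
open import Relation.Binary.Bundles using (Setoid)
import Relation.Binary.Reasoning.Setoid as SetoidReasoning
open import Level using (0ℓ)
open import Algebra.Properties.CommutativeSemigroup ℕ.+-commutativeSemigroup using (xy∙z≈xz∙y)
open import Function.Bundles using (mk⇔)
open import Defs hiding (sym)

δ : ∀ {k} → Fin k → Fin k → ℕ
δ zero    zero    = 1
δ zero    (suc _) = 0
δ (suc _) zero    = 0
δ (suc i) (suc j) = δ i j

δ-refl : ∀ {k} (i : Fin k) → δ i i ≡ 1
δ-refl zero    = refl
δ-refl (suc i) = δ-refl i

δ-≢ : ∀ {k} {i j : Fin k} → i ≢ j → δ i j ≡ 0
δ-≢ {i = zero}  {zero}  i≢j = ⊥-elim (i≢j refl)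
δ-≢ {i = zero}  {suc j} i≢j = refl
δ-≢ {i = suc i} {zero}  i≢j = refl
δ-≢ {i = suc i} {suc j} i≢j = δ-≢ (i≢j ∘ cong suc)

δ-≡ : ∀ {k} {i j : Fin k} → i ≡ j → δ i j ≡ 1
δ-≡ {i = i} refl = δ-refl i

δ-cong-⇔ : ∀ {k l} (i j : Fin k) (i' j' : Fin l) →
           (i ≡ j → i' ≡ j') → (i' ≡ j' → i ≡ j) → δ i j ≡ δ i' j'
δ-cong-⇔ i j i' j' to from with i ≟F j | i' ≟F j'
... | yes i≡j | yes i'≡j' = trans (δ-≡ i≡j) (sym (δ-≡ i'≡j'))
... | yes i≡j | no  i'≢j' = ⊥-elim (i'≢j' (to i≡j))
... | no  i≢j | yes i'≡j' = ⊥-elim (i≢j (from i'≡j'))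
... | no  i≢j | no  i'≢j' = trans (δ-≢ i≢j) (sym (δ-≢ i'≢j'))

δ-sym : ∀ {k} (i j : Fin k) → δ i j ≡ δ j i
δ-sym i j = δ-cong-⇔ i j j i sym sym

sum-zeros : ∀ k → sum {k} (λ _ → 0) ≡ 0
sum-zeros zero    = refl
sum-zeros (suc k) = sum-zeros k

sum-δ : ∀ {k} (j : Fin k) → sum (λ q → δ q j) ≡ 1
sum-δ {suc k} zero    = cong suc (sum-zeros k)
sum-δ {suc k} (suc j) = sum-δ j

sum-δ* : ∀ {k} (f : Fin k → ℕ) d → sum (λ b → δ d b * f b) ≡ f d
sum-δ* {suc k} f zero    = trans (cong₂ _+_ (ℕ.+-identityʳ (f zero)) (sum-zeros k)) (ℕ.+-identityʳ (f zero))
sum-δ* {suc k} f (suc d) = sum-δ* (f ∘ suc) d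

sum-scale : ∀ {k} c (f : Fin k → ℕ) → sum (λ q → c * f q) ≡ c * sum f
sum-scale c f = sym (*-distribˡ-sum c f)

-- Congruence modulo r = suc r', in which r' plays the role of −1.
module Modular (r' : ℕ) where

  r : ℕ
  r = suc r'

  infix 4 _≈_
  record _≈_ (a b : ℕ) : Set where
    constructor mk≈
    field mod-≡ : a % r ≡ b % r
  open _≈_ public

  ≈-refl : ∀ {a} → a ≈ a
  ≈-refl = mk≈ refl

  ≈-sym : ∀ {a b} → a ≈ b → b ≈ a
  ≈-sym (mk≈ p) = mk≈ (sym p)

  ≈-trans : ∀ {a b c} → a ≈ b → b ≈ c → a ≈ c
  ≈-trans (mk≈ p) (mk≈ q) = mk≈ (trans p q)

  ≈-reflexive : ∀ {a b} → a ≡ b → a ≈ b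
  ≈-reflexive refl = ≈-refl

  ≈-setoid : Setoid 0ℓ 0ℓ
  ≈-setoid = record
    { Carrier = ℕ ; _≈_ = _≈_
    ; isEquivalence = record { refl = ≈-refl ; sym = ≈-sym ; trans = ≈-trans } }

  module ≈-Reasoning = SetoidReasoning ≈-setoid

  _≈?_ : ∀ a b → Dec (a ≈ b)
  a ≈? b = map′ mk≈ mod-≡ (a % r ℕ.≟ b % r)

  +-cong : ∀ {a a' b b'} → a ≈ a' → b ≈ b' → a + b ≈ a' + b'
  +-cong {a} {a'} {b} {b'} (mk≈ p) (mk≈ q) = mk≈ (begin
    (a + b) % r           ≡⟨ %-distribˡ-+ a b r ⟩
    (a % r + b % r) % r   ≡⟨ cong₂ (λ u v → (u + v) % r) p q ⟩
    (a' % r + b' % r) % r ≡⟨ %-distribˡ-+ a' b' r ⟨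
    (a' + b') % r         ∎)
    where open ≡-Reasoning

  +-congˡ : ∀ a {b b'} → b ≈ b' → a + b ≈ a + b'
  +-congˡ a = +-cong (≈-refl {a})

  *-congˡ : ∀ c {b b'} → b ≈ b' → c * b ≈ c * b'
  *-congˡ c {b} {b'} (mk≈ q) = mk≈ (begin
    (c * b) % r              ≡⟨ %-distribˡ-* c b r ⟩
    (c % r * (b % r)) % r    ≡⟨ cong (λ v → (c % r * v) % r) q ⟩
    (c % r * (b' % r)) % r   ≡⟨ %-distribˡ-* c b' r ⟨
    (c * b') % r             ∎)
    where open ≡-Reasoning

  +-multiple-≈ : ∀ a k → a + k * r ≈ a
  +-multiple-≈ a k = mk≈ ([m+kn]%n≡m%n a k r)

  x+r'x≈0 : ∀ x → x + r' * x ≈ 0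
  x+r'x≈0 x = ≈-trans (≈-reflexive (ℕ.*-comm r x)) (+-multiple-≈ 0 x)

  +-cancelʳ-≈ : ∀ {a b} c → a + c ≈ b + c → a ≈ b
  +-cancelʳ-≈ {a} {b} c a+c≈b+c =
    ≈-trans (≈-sym (add-r'c a)) (≈-trans (+-cong a+c≈b+c (≈-refl {c * r'})) (add-r'c b))
    where
      expand : ∀ x c r' → (x + c) + c * r' ≡ x + c * suc r'
      expand = solve-∀
      add-r'c : ∀ x → (x + c) + c * r' ≈ x
      add-r'c x = ≈-trans (≈-reflexive (expand x c r')) (+-multiple-≈ x c)

  r'*[r'*x]≈x : ∀ x → r' * (r' * x) ≈ x
  r'*[r'*x]≈x x = ≈-trans (≈-sym (+-multiple-≈ _ x))
    (≈-trans (≈-reflexive (expand x r')) (+-multiple-≈ x (x * r')))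
    where
      expand : ∀ x r' → r' * (r' * x) + x * suc r' ≡ x + (x * r') * suc r'
      expand = solve-∀

  1≉0 : 1 < r → ¬ (1 ≈ 0)
  1≉0 1<r (mk≈ 1%r≡0) with trans (sym (m<n⇒m%n≡m 1<r)) 1%r≡0
  ... | ()

  sum-cong-≈ : ∀ {k} {f g : Fin k → ℕ} → (∀ i → f i ≈ g i) → sum f ≈ sum g
  sum-cong-≈ {zero}  f≈g = ≈-refl
  sum-cong-≈ {suc k} f≈g = +-cong (f≈g zero) (sum-cong-≈ (f≈g ∘ suc))

  skew : ∀ {I : Set} → (I → I → ℕ) → I → I → ℕ
  skew x p q = x p q + r' * x q p

  skew-≡ : ∀ {I : Set} (x : I → I → ℕ) {p q a b} → x p q ≡ a → x q p ≡ b → skew x p q ≡ a + r' * b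
  skew-≡ x = cong₂ (λ a b → a + r' * b)

  IsSkew : ∀ {k} → (Fin k → Fin k → ℕ) → Set
  IsSkew g = (∀ a b → g b a ≈ r' * g a b) × (∀ a → g a a ≈ 0)

  skew-anti : ∀ {I : Set} (x : I → I → ℕ) p q → skew x q p ≈ r' * skew x p q
  skew-anti x p q = ≈-trans (≈-reflexive (ℕ.+-comm (x q p) _))
    (≈-trans (+-congˡ (r' * x p q) (≈-sym (r'*[r'*x]≈x (x q p))))
             (≈-reflexive (sym (ℕ.*-distribˡ-+ r' (x p q) _))))

  skew-diag : ∀ {I : Set} (x : I → I → ℕ) p → skew x p p ≈ 0
  skew-diag x p = x+r'x≈0 (x p p)

  sum-skew≈0 : ∀ {k} (y : Fin k → Fin k → ℕ) → sum (λ a → sum (skew y a)) ≈ 0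
  sum-skew≈0 y = ≈-trans (≈-reflexive total) (x+r'x≈0 T)
    where
      T : ℕ
      T = sum (λ a → sum (y a))
      total : sum (λ a → sum (skew y a)) ≡ T + r' * T
      total = begin
        sum (λ a → sum (skew y a))
          ≡⟨ sum-cong-≗ (λ a → trans (∑-distrib-+ (y a) (λ b → r' * y b a))
                                     (cong (sum (y a) +_) (sum-scale r' (λ b → y b a)))) ⟩
        sum (λ a → sum (y a) + r' * sum (λ b → y b a))
          ≡⟨ ∑-distrib-+ (λ a → sum (y a)) (λ a → r' * sum (λ b → y b a)) ⟩
        T + sum (λ a → r' * sum (λ b → y b a))
          ≡⟨ cong (T +_) (trans (sum-scale r' (λ a → sum (λ b → y b a))) (cong (r' *_) (∑-comm (λ a b → y b a)))) ⟩
        T + r' * T ∎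
        where open ≡-Reasoning

-- A skew matrix modulo r is determined by its strict upper triangle, which is
-- encoded row by row in base r.
module Encoding (r' : ℕ) where
  open Modular r'

  digit : ℕ → Fin r
  digit a = fromℕ< (m%n<n a r)

  digit-cong : ∀ {a b} → a ≈ b → digit a ≡ digit b
  digit-cong {a} {b} (mk≈ e) = fromℕ<-cong _ _ e (m%n<n a r) (m%n<n b r)

  digit-injective : ∀ {a b} → digit a ≡ digit b → a ≈ b
  digit-injective {a} {b} e =
    mk≈ (trans (sym (toℕ-fromℕ< (m%n<n a r))) (trans (cong toℕ e) (toℕ-fromℕ< (m%n<n b r))))

  digit-toℕ : ∀ (d : Fin r) → digit (toℕ d) ≡ d
  digit-toℕ d = toℕ-injective (trans (toℕ-fromℕ< (m%n<n (toℕ d) r)) (m<n⇒m%n≡m (toℕ<n d)))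

  encodeRow : ∀ {k} → (Fin k → ℕ) → Fin (r ^ k)
  encodeRow {zero}  f = zero
  encodeRow {suc k} f = combine (digit (f zero)) (encodeRow (f ∘ suc))

  decodeRow : ∀ {k} → Fin (r ^ k) → Fin k → ℕ
  decodeRow {suc k} c zero    = toℕ (proj₁ (remQuot {r} (r ^ k) c))
  decodeRow {suc k} c (suc b) = decodeRow (proj₂ (remQuot {r} (r ^ k) c)) b

  encodeRow-cong : ∀ {k} {f g : Fin k → ℕ} → (∀ b → f b ≈ g b) → encodeRow f ≡ encodeRow g
  encodeRow-cong {zero}  f≈g = refl
  encodeRow-cong {suc k} f≈g = cong₂ combine (digit-cong (f≈g zero)) (encodeRow-cong (f≈g ∘ suc))

  encodeRow-injective : ∀ {k} {f g : Fin k → ℕ} → encodeRow f ≡ encodeRow g → ∀ b → f b ≈ g b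
  encodeRow-injective {suc k} e zero    = digit-injective (proj₁ (combine-injective {r} {r ^ k} _ _ _ _ e))
  encodeRow-injective {suc k} {f} {g} e (suc b) =
    encodeRow-injective {k} {f ∘ suc} {g ∘ suc}
      (proj₂ (combine-injective {r} {r ^ k} (digit (f zero)) _ (digit (g zero)) _ e)) b

  encodeRow-decodeRow : ∀ {k} (c : Fin (r ^ k)) → encodeRow {k} (decodeRow c) ≡ c
  encodeRow-decodeRow {zero}  zero = refl
  encodeRow-decodeRow {suc k} c    =
    trans (cong₂ combine (digit-toℕ (proj₁ (remQuot {r} (r ^ k) c)))
                         (encodeRow-decodeRow {k} (proj₂ (remQuot {r} (r ^ k) c))))
          (combine-remQuot {r} (r ^ k) c)

  skewCount : ℕ → ℕ
  skewCount zero    = 1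
  skewCount (suc k) = r ^ k * skewCount k

  encodeSkew : ∀ {k} → (Fin k → Fin k → ℕ) → Fin (skewCount k)
  encodeSkew {zero}  g = zero
  encodeSkew {suc k} g = combine (encodeRow (g zero ∘ suc)) (encodeSkew (λ a b → g (suc a) (suc b)))

  upperTriangle : ∀ {k} → Fin (skewCount k) → Fin k → Fin k → ℕ
  upperTriangle {suc k} c zero    zero    = 0
  upperTriangle {suc k} c zero    (suc b) = decodeRow (proj₁ (remQuot {r ^ k} (skewCount k) c)) b
  upperTriangle {suc k} c (suc a) zero    = 0
  upperTriangle {suc k} c (suc a) (suc b) = upperTriangle (proj₂ (remQuot {r ^ k} (skewCount k) c)) a b

  encodeSkew-cong : ∀ {k} {f g : Fin k → Fin k → ℕ} → (∀ a b → f a b ≈ g a b) → encodeSkew f ≡ encodeSkew g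
  encodeSkew-cong {zero}  f≈g = refl
  encodeSkew-cong {suc k} f≈g =
    cong₂ combine (encodeRow-cong (f≈g zero ∘ suc)) (encodeSkew-cong (λ a b → f≈g (suc a) (suc b)))

  encodeSkew-injective : ∀ {k} {f g : Fin k → Fin k → ℕ} → IsSkew f → IsSkew g →
                         encodeSkew f ≡ encodeSkew g → ∀ a b → f a b ≈ g a b
  encodeSkew-injective {suc k} (_ , f-diag) (_ , g-diag) e zero zero = ≈-trans (f-diag zero) (≈-sym (g-diag zero))
  encodeSkew-injective {suc k} _ _ e zero (suc b) =
    encodeRow-injective (proj₁ (combine-injective {r ^ k} {skewCount k} _ _ _ _ e)) b
  encodeSkew-injective {suc k} (f-anti , _) (g-anti , _) e (suc a) zero =
    ≈-trans (f-anti zero (suc a))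
      (≈-trans (*-congˡ r' (encodeRow-injective (proj₁ (combine-injective {r ^ k} {skewCount k} _ _ _ _ e)) a))
               (≈-sym (g-anti zero (suc a))))
  encodeSkew-injective {suc k} (f-anti , f-diag) (g-anti , g-diag) e (suc a) (suc b) =
    encodeSkew-injective ((λ a b → f-anti (suc a) (suc b)) , f-diag ∘ suc)
                         ((λ a b → g-anti (suc a) (suc b)) , g-diag ∘ suc)
                         (proj₂ (combine-injective {r ^ k} {skewCount k} _ _ _ _ e)) a b

  encodeSkew-upperTriangle : ∀ {k} (c : Fin (skewCount k)) → encodeSkew {k} (skew (upperTriangle c)) ≡ c
  encodeSkew-upperTriangle {zero}  zero = refl
  encodeSkew-upperTriangle {suc k} c    =
    trans (cong₂ combine (trans (encodeRow-cong {k} first-row) (encodeRow-decodeRow {k} row))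
                         (encodeSkew-upperTriangle {k} rest))
          (combine-remQuot {r ^ k} (skewCount k) c)
    where
      row : Fin (r ^ k)
      row = proj₁ (remQuot {r ^ k} (skewCount k) c)
      rest : Fin (skewCount k)
      rest = proj₂ (remQuot {r ^ k} (skewCount k) c)
      first-row : ∀ (b : Fin k) → decodeRow row b + r' * 0 ≈ decodeRow row b
      first-row b = ≈-reflexive (trans (cong (decodeRow row b +_) (ℕ.*-zeroʳ r')) (ℕ.+-identityʳ _))

  r≤skewCount : ∀ k → r ≤ skewCount (suc (suc k))
  r≤skewCount k = begin
    r                                ≡⟨ ℕ.*-identityʳ r ⟨
    r * 1                            ≤⟨ ℕ.*-monoʳ-≤ r (ℕ.m^n>0 r k) ⟩
    r ^ suc k                        ≡⟨ ℕ.*-identityʳ (r ^ suc k) ⟨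
    r ^ suc k * 1                    ≤⟨ ℕ.*-monoʳ-≤ (r ^ suc k) (1≤skewCount (suc k)) ⟩
    r ^ suc k * skewCount (suc k)    ∎
    where
      1≤skewCount : ∀ k → 1 ≤ skewCount k
      1≤skewCount zero    = ℕ.≤-refl
      1≤skewCount (suc k) = ℕ.*-mono-≤ (ℕ.m^n>0 r k) (1≤skewCount k)
      open ℕ.≤-Reasoning

from-does : ∀ {P : Set} (p? : Dec P) → does p? ≡ true → P
from-does (yes p) _  = p
from-does (no _)  ()

transpose-matchˡ : ∀ {m} (i j : Fin m) → PC.transpose i j i ≡ j
transpose-matchˡ i j with i ≟F i
... | yes _  = refl
... | no i≢i = ⊥-elim (i≢i refl)

transpose-other : ∀ {m} (i j k : Fin m) → k ≢ i → k ≢ j → PC.transpose i j k ≡ k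
transpose-other i j k k≢i k≢j with k ≟F i
... | yes k≡i = ⊥-elim (k≢i k≡i)
... | no _ with k ≟F j
...   | yes k≡j = ⊥-elim (k≢j k≡j)
...   | no _    = refl

transpose-injective : ∀ {m} (i j a b : Fin m) → PC.transpose i j a ≡ PC.transpose i j b → a ≡ b
transpose-injective i j a b e =
  trans (sym (PC.transpose-inverse j i)) (trans (cong (PC.transpose j i) e) (PC.transpose-inverse j i))

Sym-2-transitive : ∀ {m} (k₀ k₂ l₀ l₂ : Fin m) → k₀ ≢ k₂ → l₀ ≢ l₂ →
                   ∃[ π ] (π ⟨$⟩ʳ k₀ ≡ l₀ × π ⟨$⟩ʳ k₂ ≡ l₂)
Sym-2-transitive {m} k₀ k₂ l₀ l₂ k₀≢k₂ l₀≢l₂ = transpose k₀ l₀ ∘ₚ transpose k₂' l₂ , k₀↦l₀ , transpose-matchˡ k₂' l₂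
  where
    k₂' : Fin m
    k₂' = PC.transpose k₀ l₀ k₂
    l₀≢k₂' : l₀ ≢ k₂'
    l₀≢k₂' e = k₀≢k₂ (transpose-injective k₀ l₀ k₀ k₂ (trans (transpose-matchˡ k₀ l₀) e))
    k₀↦l₀ : PC.transpose k₂' l₂ (PC.transpose k₀ l₀ k₀) ≡ l₀
    k₀↦l₀ = trans (cong (PC.transpose k₂' l₂) (transpose-matchˡ k₀ l₀)) (transpose-other k₂' l₂ l₀ l₀≢k₂' l₀≢l₂)

module _ {n} {Γ : Graph n} where

  Edge-sym : ∀ {x y} → Edge Γ x y → Edge Γ y x
  Edge-sym {x} {y} e = trans (Graph.sym Γ y x) e

  Reach-trans : ∀ {x y z} → Reach Γ x y → Reach Γ y z → Reach Γ x z
  Reach-trans here       w = w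
  Reach-trans (step e v) w = step e (Reach-trans v w)

  Reach-snoc : ∀ {x y z} → Reach Γ x y → Edge Γ y z → Reach Γ x z
  Reach-snoc w e = Reach-trans w (step e here)

  Reach-sym : ∀ {x y} → Reach Γ x y → Reach Γ y x
  Reach-sym here       = here
  Reach-sym (step e w) = Reach-snoc (Reach-sym w) (Edge-sym e)

  module _ {G : Perm n → Set} (isAut : IsAutGroup Γ G) where
    open IsAutGroup isAut
    open IsPermGroup isGroup

    Edge-map : ∀ {g x y} → G g → Edge Γ x y → Edge Γ (g x) (g y)
    Edge-map g∈G e = trans (preserves g∈G _ _) e

    Reach-map : ∀ {g x y} → G g → Reach Γ x y → Reach Γ (g x) (g y)
    Reach-map g∈G here       = here
    Reach-map g∈G (step e w) = step (Edge-map g∈G e) (Reach-map g∈G w)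

    connected-from : ∀ α → (∀ x → Reach Γ α x) → Connected Γ
    connected-from α reach x y = Reach-trans (Reach-sym (reach x)) (reach y)

third-element : ∀ {m} → 3 ≤ m → ∀ (i j : Fin m) → ∃[ a ] (a ≢ i × a ≢ j)
third-element (s≤s (s≤s (s≤s _))) i j with zero ≟F i | zero ≟F j
... | no 0≢i    | no 0≢j = zero , 0≢i , 0≢j
... | yes refl  | no 0≢j with suc zero ≟F j
...   | no 1≢j   = suc zero , (λ ()) , 1≢j
...   | yes refl = suc (suc zero) , (λ ()) , (λ ())
third-element (s≤s (s≤s (s≤s _))) i j | no 0≢i | yes refl with suc zero ≟F i
...   | no 1≢i   = suc zero , 1≢i , (λ ())
...   | yes refl = suc (suc zero) , (λ ()) , (λ ())
third-element (s≤s (s≤s (s≤s _))) i j | yes refl | yes refl = suc zero , (λ ()) , (λ ())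

-- The 2m endpoints of a matching of Γ_N lie in distinct N-orbits.
qMatching-size : ∀ {n k m} {Γ : Graph n} {N : Perm n → Set} (f : Fin n → Fin k) →
                 (∀ x y → f x ≡ f y → SameOrbit N x y) → QMatching m Γ N → m + m ≤ k
qMatching-size {k = k} {m = m} f f-orbit M =
  injective⇒≤ {f = endpoint ∘ splitAt m} (splitAt-injective ∘ endpoint-injective _ _)
  where
    endpoint : Fin m ⊎ Fin m → Fin k
    endpoint (inj₁ a) = f (qu M a)
    endpoint (inj₂ b) = f (qv M b)
    endpoint-injective : ∀ s t → endpoint s ≡ endpoint t → s ≡ t
    endpoint-injective (inj₁ a) (inj₁ b) e = cong inj₁ (quu M a b (f-orbit _ _ e))
    endpoint-injective (inj₂ a) (inj₂ b) e = cong inj₂ (qvv M a b (f-orbit _ _ e))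
    endpoint-injective (inj₁ a) (inj₂ b) e = ⊥-elim (quv M a b (f-orbit _ _ e))
    endpoint-injective (inj₂ a) (inj₁ b) e = ⊥-elim (quv M b a (f-orbit _ _ (sym e)))
    splitAt-injective : ∀ {i j} → splitAt m i ≡ splitAt m j → i ≡ j
    splitAt-injective {i} {j} e = trans (sym (join-splitAt m m i)) (trans (cong (join m m) e) (join-splitAt m m j))

module FibredAutomorphisms {n} (Γ : Graph n) {F : Set} (fibre : Fin n → F) where

  PreservesFibres : Perm n → Set
  PreservesFibres g = ∀ x y → (fibre x ≡ fibre y → fibre (g x) ≡ fibre (g y))
                            × (fibre (g x) ≡ fibre (g y) → fibre x ≡ fibre y)

  G : Perm n → Set
  G g = Σ (Perm n) (IsInverse g) × (∀ x y → adj Γ (g x) (g y) ≡ adj Γ x y) × PreservesFibres g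

  N : Perm n → Set
  N g = G g × (∀ x → fibre (g x) ≡ fibre x)

  G-inverse : ∀ {g h} → G g → IsInverse g h → G h
  G-inverse {g} {h} (_ , preserves , fibres) (hg , gh) =
      (g , gh , hg)
    , (λ x y → trans (sym (preserves (h x) (h y))) (cong₂ (adj Γ) (gh x) (gh y)))
    , (λ x y → (λ e → proj₂ (fibres (h x) (h y)) (trans (cong fibre (gh x)) (trans e (cong fibre (sym (gh y))))))
             , (λ e → trans (cong fibre (sym (gh x))) (trans (proj₁ (fibres (h x) (h y)) e) (cong fibre (gh y)))))

  G-id : G id
  G-id = (id , (λ _ → refl) , (λ _ → refl)) , (λ _ _ → refl) , (λ _ _ → id , id)

  G-∘ : ∀ {g h} → G g → G h → G (g ∘ h)
  G-∘ {g} {h} ((g⁻¹ , g⁻¹g , gg⁻¹) , g-adj , g-fibres) ((h⁻¹ , h⁻¹h , hh⁻¹) , h-adj , h-fibres) =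
      (h⁻¹ ∘ g⁻¹ , (λ x → trans (cong h⁻¹ (g⁻¹g (h x))) (h⁻¹h x)) , (λ x → trans (cong g (hh⁻¹ (g⁻¹ x))) (gg⁻¹ x)))
    , (λ x y → trans (g-adj (h x) (h y)) (h-adj x y))
    , (λ x y → proj₁ (g-fibres (h x) (h y)) ∘ proj₁ (h-fibres x y)
             , proj₂ (h-fibres x y) ∘ proj₂ (g-fibres (h x) (h y)))

  G-isPermGroup : IsPermGroup G
  G-isPermGroup = record
    { id∈   = G-id
    ; comp∈ = G-∘
    ; inv∈  = λ g∈G → proj₁ (proj₁ g∈G) , G-inverse g∈G (proj₂ (proj₁ g∈G)) , proj₂ (proj₁ g∈G)
    }

  G-isAutGroup : IsAutGroup Γ G
  G-isAutGroup = record { isGroup = G-isPermGroup ; preserves = proj₁ ∘ proj₂ }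

  N-isPermGroup : IsPermGroup N
  N-isPermGroup = record
    { id∈   = G-id , (λ _ → refl)
    ; comp∈ = λ {g} {h} (g∈G , g-fix) (h∈G , h-fix) → G-∘ g∈G h∈G , (λ x → trans (g-fix (h x)) (h-fix x))
    ; inv∈  = λ (g∈G@((g⁻¹ , g⁻¹g , gg⁻¹) , _) , g-fix) →
          g⁻¹
        , (G-inverse g∈G (g⁻¹g , gg⁻¹) , (λ x → trans (sym (g-fix (g⁻¹ x))) (cong fibre (gg⁻¹ x))))
        , (g⁻¹g , gg⁻¹)
    }

  N-normal : IsNormalSubgroup G N
  N-normal = record
    { isGroup = N-isPermGroup
    ; sub     = proj₁
    ; normal  = λ {g} {h} {g'} g∈G (h∈G , h-fix) g'-inv →
        G-∘ g∈G (G-∘ h∈G (G-inverse g∈G g'-inv))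
      , (λ x → trans (proj₁ (proj₂ (proj₂ g∈G) (h (g' x)) (g' x)) (h-fix (g' x))) (cong fibre (proj₂ g'-inv x)))
    }

StabiliserInducesSym : ∀ {n} → ℕ → Graph n → (Perm n → Set) → Fin n → Set
StabiliserInducesSym {n} m Γ G α =
  Σ (Fin m → Fin n) λ e →
    (∀ i j → e i ≡ e j → i ≡ j) ×
    (∀ β → Edge Γ α β → ∃[ i ] (e i ≡ β)) ×
    (∀ i → Edge Γ α (e i)) ×
    (∀ (π : Permutation′ m) → ∃[ g ] (G g × g α ≡ α × (∀ i → g (e i) ≡ e (π ⟨$⟩ʳ i))))

-- It suffices to check the local action at a single vertex α₀; 2-arc-transitivity
-- then follows because S_m is 2-transitive.
module LocalCriterion {n} {Γ : Graph n} {G : Perm n → Set} (isAut : IsAutGroup Γ G)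
                      (α₀ : Fin n) (to-α₀ : ∀ x → ∃[ g ] (G g × g x ≡ α₀)) where
  open IsAutGroup isAut
  open IsPermGroup isGroup

  G-injective : ∀ {g} → G g → ∀ {x y} → g x ≡ g y → x ≡ y
  G-injective g∈G {x} {y} gx≡gy with inv∈ g∈G
  ... | g⁻¹ , _ , g⁻¹g , _ = trans (sym (g⁻¹g x)) (trans (cong g⁻¹ gx≡gy) (g⁻¹g y))

  from-α₀ : ∀ y → ∃[ h ] (G h × h α₀ ≡ y)
  from-α₀ y with to-α₀ y
  ... | g , g∈G , gy≡α₀ with inv∈ g∈G
  ...   | g⁻¹ , g⁻¹∈G , g⁻¹g , _ = g⁻¹ , g⁻¹∈G , trans (cong g⁻¹ (sym gy≡α₀)) (g⁻¹g y)

  vertexTransitive : VertexTransitive G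
  vertexTransitive x y with to-α₀ x | from-α₀ y
  ... | g , g∈G , gx≡α₀ | h , h∈G , hα₀≡y = h ∘ g , comp∈ h∈G g∈G , trans (cong h gx≡α₀) hα₀≡y

  module _ {m} (e : Fin m → Fin n)
           (e-injective : ∀ i j → e i ≡ e j → i ≡ j)
           (e-onto : ∀ β → Edge Γ α₀ β → ∃[ i ] (e i ≡ β))
           (e-edge : ∀ i → Edge Γ α₀ (e i))
           (e-sym : ∀ (π : Permutation′ m) → ∃[ g ] (G g × g α₀ ≡ α₀ × (∀ i → g (e i) ≡ e (π ⟨$⟩ʳ i))))
           where

    localIndex : ∀ {g x y} → G g → g x ≡ α₀ → Edge Γ x y → ∃[ i ] (e i ≡ g y)
    localIndex {g} {x} {y} g∈G gx≡α₀ xy = e-onto (g y) (subst (λ z → Edge Γ z (g y)) gx≡α₀ (Edge-map isAut g∈G xy))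

    locallySym : LocallySym m Γ G
    locallySym = vertexTransitive , local
      where
        local : ∀ α → StabiliserInducesSym m Γ G α
        local α with to-α₀ α
        ... | g , g∈G , gα≡α₀ with inv∈ g∈G
        ...   | g⁻¹ , g⁻¹∈G , g⁻¹g , gg⁻¹ = g⁻¹ ∘ e , injective , onto , edge , sym-action
          where
            g⁻¹α₀≡α : g⁻¹ α₀ ≡ α
            g⁻¹α₀≡α = trans (cong g⁻¹ (sym gα≡α₀)) (g⁻¹g α)
            injective : ∀ i j → g⁻¹ (e i) ≡ g⁻¹ (e j) → i ≡ j
            injective i j q = e-injective i j (trans (sym (gg⁻¹ (e i))) (trans (cong g q) (gg⁻¹ (e j))))
            onto : ∀ β → Edge Γ α β → ∃[ i ] (g⁻¹ (e i) ≡ β)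
            onto β αβ with localIndex g∈G gα≡α₀ αβ
            ... | i , eᵢ≡gβ = i , trans (cong g⁻¹ eᵢ≡gβ) (g⁻¹g β)
            edge : ∀ i → Edge Γ α (g⁻¹ (e i))
            edge i = subst (λ z → Edge Γ z (g⁻¹ (e i))) g⁻¹α₀≡α (Edge-map isAut g⁻¹∈G (e-edge i))
            sym-action : ∀ (π : Permutation′ m) →
                         ∃[ h ] (G h × h α ≡ α × (∀ i → h (g⁻¹ (e i)) ≡ g⁻¹ (e (π ⟨$⟩ʳ i))))
            sym-action π with e-sym π
            ... | k , k∈G , kα₀≡α₀ , k-e =
                g⁻¹ ∘ k ∘ g , comp∈ g⁻¹∈G (comp∈ k∈G g∈G)
              , trans (cong (g⁻¹ ∘ k) gα≡α₀) (trans (cong g⁻¹ kα₀≡α₀) g⁻¹α₀≡α)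
              , λ i → trans (cong (g⁻¹ ∘ k) (gg⁻¹ (e i))) (cong g⁻¹ (k-e i))

    twoArcTransitive : TwoArcTransitive Γ G
    twoArcTransitive a₀ a₁ a₂ b₀ b₁ b₂ (a₀a₁ , a₁a₂ , a₀≢a₂) (b₀b₁ , b₁b₂ , b₀≢b₂)
      with to-α₀ a₁ | to-α₀ b₁
    ... | g , g∈G , ga₁≡α₀ | h , h∈G , hb₁≡α₀ with inv∈ h∈G
    ...   | h⁻¹ , h⁻¹∈G , h⁻¹h , _ with localIndex g∈G ga₁≡α₀ (Edge-sym {Γ = Γ} a₀a₁) | localIndex g∈G ga₁≡α₀ a₁a₂
                                     | localIndex h∈G hb₁≡α₀ (Edge-sym {Γ = Γ} b₀b₁) | localIndex h∈G hb₁≡α₀ b₁b₂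
    ...     | i₀ , eᵢ₀ | i₂ , eᵢ₂ | j₀ , eⱼ₀ | j₂ , eⱼ₂ with Sym-2-transitive i₀ i₂ j₀ j₂ i₀≢i₂ j₀≢j₂
      where
        i₀≢i₂ : i₀ ≢ i₂
        i₀≢i₂ q = a₀≢a₂ (G-injective g∈G (trans (sym eᵢ₀) (trans (cong e q) eᵢ₂)))
        j₀≢j₂ : j₀ ≢ j₂
        j₀≢j₂ q = b₀≢b₂ (G-injective h∈G (trans (sym eⱼ₀) (trans (cong e q) eⱼ₂)))
    ...       | π , πi₀≡j₀ , πi₂≡j₂ with e-sym π
    ...         | k , k∈G , kα₀≡α₀ , k-e =
        h⁻¹ ∘ k ∘ g , comp∈ h⁻¹∈G (comp∈ k∈G g∈G)
      , moves eᵢ₀ πi₀≡j₀ eⱼ₀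
      , trans (cong (h⁻¹ ∘ k) ga₁≡α₀) (trans (cong h⁻¹ (trans kα₀≡α₀ (sym hb₁≡α₀))) (h⁻¹h b₁))
      , moves eᵢ₂ πi₂≡j₂ eⱼ₂
      where
        moves : ∀ {x y i j} → e i ≡ g x → π ⟨$⟩ʳ i ≡ j → e j ≡ h y → h⁻¹ (k (g x)) ≡ y
        moves {x} {y} {i} eᵢ πi≡j eⱼ =
          trans (cong (h⁻¹ ∘ k) (sym eᵢ))
            (trans (cong h⁻¹ (trans (k-e i) (trans (cong e πi≡j) eⱼ))) (h⁻¹h y))

-- Chains are stored as ℕ-matrices x; the Z_r-chain they denote is their skew part
-- x p q − x q p, and ∂ is the boundary of that chain.
module HomologyCover (m r' : ℕ) where
  open Modular r'
  open Encoding r'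

  Base : Set
  Base = Fin (suc m)

  Chain : Set
  Chain = Base → Base → ℕ

  infixl 6 _⊕_
  infixr 7 _·_

  _⊕_ : Chain → Chain → Chain
  (x ⊕ y) p q = x p q + y p q

  _·_ : ℕ → Chain → Chain
  (c · x) p q = c * x p q

  0C : Chain
  0C _ _ = 0

  edge : Base → Base → Chain
  edge i j p q = δ p i * δ q j

  infix 4 _≈C_
  record _≈C_ (x y : Chain) : Set where
    constructor pointwise
    field at : ∀ p q → skew x p q ≈ skew y p q
  open _≈C_ public

  ≈C-refl : ∀ {x} → x ≈C x
  ≈C-refl = pointwise λ p q → ≈-refl

  ≈C-sym : ∀ {x y} → x ≈C y → y ≈C x
  ≈C-sym x≈y = pointwise λ p q → ≈-sym (at x≈y p q)

  ≈C-trans : ∀ {x y z} → x ≈C y → y ≈C z → x ≈C z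
  ≈C-trans x≈y y≈z = pointwise λ p q → ≈-trans (at x≈y p q) (at y≈z p q)

  ≈C-reflexive : ∀ {x y} → (∀ p q → x p q ≡ y p q) → x ≈C y
  ≈C-reflexive {x} x≡y = pointwise λ p q → ≈-reflexive (skew-≡ x (x≡y p q) (x≡y q p))

  ⊕-assoc : ∀ x y z → x ⊕ y ⊕ z ≈C x ⊕ (y ⊕ z)
  ⊕-assoc x y z = ≈C-reflexive (λ p q → ℕ.+-assoc (x p q) (y p q) (z p q))

  ⊕-right-comm : ∀ x y z → x ⊕ y ⊕ z ≈C x ⊕ z ⊕ y
  ⊕-right-comm x y z = ≈C-reflexive (λ p q → xy∙z≈xz∙y (x p q) (y p q) (z p q))

  ∂ : Chain → Base → ℕ
  ∂ x p = sum (skew x p)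

  Joins : Base → Chain → Set
  Joins i x = ∀ p → ∂ x p ≈ δ p zero + r' * δ p i

  IsCycle : Chain → Set
  IsCycle x = ∀ p → ∂ x p ≈ 0

  skew-⊕ : ∀ x y p q → skew (x ⊕ y) p q ≡ skew x p q + skew y p q
  skew-⊕ x y p q = expand (x p q) (y p q) (x q p) (y q p) r'
    where
      expand : ∀ a b c d r' → (a + b) + r' * (c + d) ≡ (a + r' * c) + (b + r' * d)
      expand = solve-∀

  skew-· : ∀ c x p q → skew (c · x) p q ≡ c * skew x p q
  skew-· c x p q = expand c (x p q) (x q p) r'
    where
      expand : ∀ c a b r' → c * a + r' * (c * b) ≡ c * (a + r' * b)
      expand = solve-∀

  skew-0C : ∀ p q → skew 0C p q ≡ 0
  skew-0C p q = ℕ.*-zeroʳ r'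

  ⊕-cong : ∀ {x x' y y'} → x ≈C x' → y ≈C y' → x ⊕ y ≈C x' ⊕ y'
  ⊕-cong {x} {x'} {y} {y'} x≈x' y≈y' = pointwise λ p q → begin
    skew (x ⊕ y) p q              ≡⟨ skew-⊕ x y p q ⟩
    skew x p q + skew y p q       ≈⟨ +-cong (at x≈x' p q) (at y≈y' p q) ⟩
    skew x' p q + skew y' p q     ≡⟨ skew-⊕ x' y' p q ⟨
    skew (x' ⊕ y') p q            ∎
    where open ≈-Reasoning

  ⊕-cancel : ∀ x c → x ⊕ c ⊕ r' · c ≈C x
  ⊕-cancel x c = pointwise λ p q → begin
    skew (x ⊕ c ⊕ r' · c) p q                              ≡⟨ trans (skew-⊕ (x ⊕ c) (r' · c) p q)
                                                                    (cong₂ _+_ (skew-⊕ x c p q) (skew-· r' c p q)) ⟩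
    skew x p q + skew c p q + r' * skew c p q              ≡⟨ ℕ.+-assoc (skew x p q) _ _ ⟩
    skew x p q + (skew c p q + r' * skew c p q)            ≈⟨ +-congˡ (skew x p q) (x+r'x≈0 (skew c p q)) ⟩
    skew x p q + 0                                         ≡⟨ ℕ.+-identityʳ _ ⟩
    skew x p q                                             ∎
    where open ≈-Reasoning

  ⊕-difference : ∀ x y → x ⊕ (y ⊕ r' · x) ≈C y
  ⊕-difference x y = ≈C-trans (≈C-reflexive (λ p q → regroup (x p q) (y p q) (r' * x p q))) (⊕-cancel y x)
    where
      regroup : ∀ a b c → a + (b + c) ≡ b + a + c
      regroup = solve-∀

  ⊕-trivial : ∀ x t → (∀ p q → skew t p q ≈ 0) → x ⊕ t ≈C x
  ⊕-trivial x t t≈0 = pointwise λ p q → begin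
    skew (x ⊕ t) p q            ≡⟨ skew-⊕ x t p q ⟩
    skew x p q + skew t p q     ≈⟨ +-congˡ (skew x p q) (t≈0 p q) ⟩
    skew x p q + 0              ≡⟨ ℕ.+-identityʳ _ ⟩
    skew x p q                  ∎
    where open ≈-Reasoning

  edge-loop : ∀ i p q → skew (edge i i) p q ≈ 0
  edge-loop i p q =
    ≈-trans (≈-reflexive (cong (λ t → edge i i p q + r' * t) (ℕ.*-comm (δ q i) (δ p i)))) (x+r'x≈0 _)

  ⊕-loop : ∀ x i → x ⊕ edge i i ≈C x
  ⊕-loop x i = ⊕-trivial x (edge i i) (edge-loop i)

  edge-reverse : ∀ i j p q → skew (edge i j ⊕ edge j i) p q ≈ 0
  edge-reverse i j p q = ≈-trans (≈-reflexive (regroup (δ p i) (δ q j) (δ q i) (δ p j) r')) (x+r'x≈0 _)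
    where
      regroup : ∀ a b c d r' → (a * b + d * c) + r' * (c * d + b * a) ≡ (a * b + d * c) + r' * (a * b + d * c)
      regroup = solve-∀

  ∂-⊕ : ∀ x y p → ∂ (x ⊕ y) p ≡ ∂ x p + ∂ y p
  ∂-⊕ x y p = trans (sum-cong-≗ (skew-⊕ x y p)) (∑-distrib-+ (skew x p) (skew y p))

  ∂-· : ∀ c x p → ∂ (c · x) p ≡ c * ∂ x p
  ∂-· c x p = trans (sum-cong-≗ (skew-· c x p)) (sum-scale c (skew x p))

  ∂-edge : ∀ i j p → ∂ (edge i j) p ≡ δ p i + r' * δ p j
  ∂-edge i j p = begin
    sum (λ q → δ p i * δ q j + r' * (δ q i * δ p j))
      ≡⟨ sum-cong-≗ (λ q → cong (δ p i * δ q j +_) (reorder r' (δ q i) (δ p j))) ⟩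
    sum (λ q → δ p i * δ q j + (r' * δ p j) * δ q i)
      ≡⟨ ∑-distrib-+ (λ q → δ p i * δ q j) (λ q → (r' * δ p j) * δ q i) ⟩
    sum (λ q → δ p i * δ q j) + sum (λ q → (r' * δ p j) * δ q i)
      ≡⟨ cong₂ _+_ (sum-scale (δ p i) (λ q → δ q j)) (sum-scale (r' * δ p j) (λ q → δ q i)) ⟩
    δ p i * sum (λ q → δ q j) + (r' * δ p j) * sum (λ q → δ q i)
      ≡⟨ cong₂ (λ u v → δ p i * u + (r' * δ p j) * v) (sum-δ j) (sum-δ i) ⟩
    δ p i * 1 + (r' * δ p j) * 1
      ≡⟨ cong₂ _+_ (ℕ.*-identityʳ (δ p i)) (ℕ.*-identityʳ (r' * δ p j)) ⟩
    δ p i + r' * δ p j ∎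
    where
      open ≡-Reasoning
      reorder : ∀ r' a b → r' * (a * b) ≡ (r' * b) * a
      reorder = solve-∀

  0C-isCycle : IsCycle 0C
  0C-isCycle p = ≈-reflexive (trans (sum-cong-≗ (skew-0C p)) (sum-zeros (suc m)))

  isCycle-⊕ : ∀ {x y} → IsCycle x → IsCycle y → IsCycle (x ⊕ y)
  isCycle-⊕ {x} {y} x-cyc y-cyc p = ≈-trans (≈-reflexive (∂-⊕ x y p)) (+-cong (x-cyc p) (y-cyc p))

  isCycle-· : ∀ c {x} → IsCycle x → IsCycle (c · x)
  isCycle-· c {x} x-cyc p =
    ≈-trans (≈-reflexive (∂-· c x p)) (≈-trans (*-congˡ c (x-cyc p)) (≈-reflexive (ℕ.*-zeroʳ c)))

  joins-⊕-cycle : ∀ {i x c} → Joins i x → IsCycle c → Joins i (x ⊕ c)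
  joins-⊕-cycle {i} {x} {c} x-joins c-cyc p =
    ≈-trans (≈-reflexive (∂-⊕ x c p)) (≈-trans (+-cong (x-joins p) (c-cyc p)) (≈-reflexive (ℕ.+-identityʳ _)))

  joins-⊕-edge : ∀ {i x} j → Joins i x → Joins j (x ⊕ edge i j)
  joins-⊕-edge {i} {x} j x-joins p = begin
    ∂ (x ⊕ edge i j) p                             ≡⟨ trans (∂-⊕ x (edge i j) p) (cong (∂ x p +_) (∂-edge i j p)) ⟩
    ∂ x p + (δ p i + r' * δ p j)                   ≈⟨ +-cong (x-joins p) ≈-refl ⟩
    (δ p zero + r' * δ p i) + (δ p i + r' * δ p j) ≡⟨ regroup (δ p zero) (δ p i) (δ p j) r' ⟩
    (δ p zero + r' * δ p j) + (δ p i + r' * δ p i) ≈⟨ +-congˡ (δ p zero + r' * δ p j) (x+r'x≈0 (δ p i)) ⟩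
    (δ p zero + r' * δ p j) + 0                    ≡⟨ ℕ.+-identityʳ _ ⟩
    δ p zero + r' * δ p j                          ∎
    where
      open ≈-Reasoning
      regroup : ∀ a b c r' → (a + r' * b) + (b + r' * c) ≡ (a + r' * c) + (b + r' * b)
      regroup = solve-∀

  joins-difference : ∀ {i x y} → Joins i x → Joins i y → IsCycle (y ⊕ r' · x)
  joins-difference {i} {x} {y} x-joins y-joins p = begin
    ∂ (y ⊕ r' · x) p                                       ≡⟨ trans (∂-⊕ y (r' · x) p) (cong (∂ y p +_) (∂-· r' x p)) ⟩
    ∂ y p + r' * ∂ x p                                     ≈⟨ +-cong (y-joins p) (*-congˡ r' (x-joins p)) ⟩
    (δ p zero + r' * δ p i) + r' * (δ p zero + r' * δ p i) ≈⟨ x+r'x≈0 _ ⟩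
    0                                                      ∎
    where open ≈-Reasoning

  cycle⇒joins₀ : ∀ {x} → IsCycle x → Joins zero x
  cycle⇒joins₀ x-cyc p = ≈-trans (x-cyc p) (≈-sym (x+r'x≈0 (δ p zero)))

  joins₀⇒cycle : ∀ {x} → Joins zero x → IsCycle x
  joins₀⇒cycle x-joins p = ≈-trans (x-joins p) (x+r'x≈0 (δ p zero))

  record Vertex : Set where
    constructor vertex
    field
      fibre : Base
      chain : Chain
      joins : Joins fibre chain
  open Vertex public

  infix 4 _≈V_
  record _≈V_ (v w : Vertex) : Set where
    constructor _∣_
    field
      fibre-≡ : fibre v ≡ fibre w
      chain-≈ : chain v ≈C chain w
  open _≈V_ public

  ≈V-refl : ∀ {v} → v ≈V v
  ≈V-refl = refl ∣ ≈C-refl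

  ≈V-sym : ∀ {v w} → v ≈V w → w ≈V v
  ≈V-sym (e ∣ c) = sym e ∣ ≈C-sym c

  ≈V-trans : ∀ {u v w} → u ≈V v → v ≈V w → u ≈V w
  ≈V-trans (e ∣ c) (e' ∣ c') = trans e e' ∣ ≈C-trans c c'

  inner : Chain → Fin m → Fin m → ℕ
  inner x a b = skew x (suc a) (suc b)

  ≈C-from-inner : ∀ {i x x'} → Joins i x → Joins i x' → (∀ a b → inner x a b ≈ inner x' a b) → x ≈C x'
  ≈C-from-inner {i} {x} {x'} x-joins x'-joins inner≈ = pointwise go
    where
      column : ∀ a → skew x (suc a) zero ≈ skew x' (suc a) zero
      column a = +-cancelʳ-≈ (sum (inner x' a))
        (≈-trans (+-congˡ (skew x (suc a) zero) (sum-cong-≈ (λ b → ≈-sym (inner≈ a b))))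
                 (≈-trans (x-joins (suc a)) (≈-sym (x'-joins (suc a)))))
      go : ∀ p q → skew x p q ≈ skew x' p q
      go zero    zero    = ≈-trans (skew-diag x zero) (≈-sym (skew-diag x' zero))
      go zero    (suc b) = ≈-trans (skew-anti x (suc b) zero)
                             (≈-trans (*-congˡ r' (column b)) (≈-sym (skew-anti x' (suc b) zero)))
      go (suc a) zero    = column a
      go (suc a) (suc b) = inner≈ a b

  -- The first column is forced by the boundary condition; the first row is left 0.
  extend : Base → (Fin m → Fin m → ℕ) → Chain
  extend i y zero    q       = 0
  extend i y (suc a) zero    = r' * (δ (suc a) i + sum (skew y a))
  extend i y (suc a) (suc b) = y a b

  extend-joins : ∀ i y → Joins i (extend i y)
  extend-joins i y (suc a) = begin
    (r' * (δ (suc a) i + ∂y) + r' * 0) + ∂y   ≡⟨ regroup (δ (suc a) i) ∂y r' ⟩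
    r' * δ (suc a) i + (∂y + r' * ∂y)         ≈⟨ +-congˡ (r' * δ (suc a) i) (x+r'x≈0 ∂y) ⟩
    r' * δ (suc a) i + 0                      ≡⟨ ℕ.+-identityʳ _ ⟩
    r' * δ (suc a) i                          ∎
    where
      open ≈-Reasoning
      ∂y : ℕ
      ∂y = sum (skew y a)
      regroup : ∀ d s r' → (r' * (d + s) + r' * 0) + s ≡ r' * d + (s + r' * s)
      regroup = solve-∀
  extend-joins i y zero = begin
    r' * 0 + sum (λ a → r' * (r' * column a))  ≡⟨ cong (_+ sum (λ a → r' * (r' * column a))) (ℕ.*-zeroʳ r') ⟩
    sum (λ a → r' * (r' * column a))           ≈⟨ sum-cong-≈ {g = column} (λ a → r'*[r'*x]≈x (column a)) ⟩
    sum (λ a → δ (suc a) i + ∂y a)             ≡⟨ ∑-distrib-+ (λ a → δ (suc a) i) ∂y ⟩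
    Sδ + sum ∂y                                ≈⟨ +-congˡ Sδ (sum-skew≈0 y) ⟩
    Sδ + 0                                     ≈⟨ +-congˡ Sδ (≈-sym (x+r'x≈0 (δ zero i))) ⟩
    Sδ + (δ zero i + r' * δ zero i)            ≡⟨ ℕ.+-assoc Sδ (δ zero i) _ ⟨
    Sδ + δ zero i + r' * δ zero i              ≡⟨ cong (_+ r' * δ zero i) (trans (ℕ.+-comm Sδ _) (sum-δ i)) ⟩
    1 + r' * δ zero i                          ∎
    where
      open ≈-Reasoning
      ∂y : Fin m → ℕ
      ∂y = λ a → sum (skew y a)
      column : Fin m → ℕ
      column = λ a → δ (suc a) i + ∂y a
      Sδ : ℕ
      Sδ = sum (λ a → δ (suc a) i)

  n : ℕ
  n = suc m * skewCount m

  encode : Vertex → Fin n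
  encode v = combine (fibre v) (encodeSkew (inner (chain v)))

  decode : Fin n → Vertex
  decode k = vertex i (extend i y) (extend-joins i y)
    where
      i : Base
      i = proj₁ (remQuot {suc m} (skewCount m) k)
      y : Fin m → Fin m → ℕ
      y = upperTriangle (proj₂ (remQuot {suc m} (skewCount m) k))

  r≤n : 2 ≤ m → r ≤ n
  r≤n (s≤s (s≤s {n = j} _)) = ℕ.≤-trans (r≤skewCount j) (ℕ.m≤n*m (skewCount m) (suc m))

  fibreOf : Fin n → Base
  fibreOf k = fibre (decode k)

  encode-cong : ∀ {v w} → v ≈V w → encode v ≡ encode w
  encode-cong (e ∣ c) = cong₂ combine e (encodeSkew-cong (λ a b → at c (suc a) (suc b)))

  encode-injective : ∀ {v w} → encode v ≡ encode w → v ≈V w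
  encode-injective {vertex i x x-joins} {vertex j y y-joins} e
    with combine-injective {suc m} {skewCount m} i _ j _ e
  ... | refl , inner-≡ =
    refl ∣ ≈C-from-inner x-joins y-joins (encodeSkew-injective (inner-isSkew x) (inner-isSkew y) inner-≡)
    where
      inner-isSkew : ∀ x → IsSkew (inner x)
      inner-isSkew x = (λ a b → skew-anti x (suc a) (suc b)) , (λ a → skew-diag x (suc a))

  encode-decode : ∀ k → encode (decode k) ≡ k
  encode-decode k =
    trans (cong (combine (proj₁ (remQuot {suc m} (skewCount m) k)))
                (encodeSkew-upperTriangle {m} (proj₂ (remQuot {suc m} (skewCount m) k))))
          (combine-remQuot {suc m} (skewCount m) k)

  decode-encode : ∀ v → decode (encode v) ≈V v
  decode-encode v = encode-injective (encode-decode (encode v))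

  record Adjacent (v w : Vertex) : Set where
    constructor adjacent
    field
      distinct : fibre v ≢ fibre w
      extends  : chain w ≈C chain v ⊕ edge (fibre v) (fibre w)
  open Adjacent public

  adjacent? : ∀ v w → Dec (Adjacent v w)
  adjacent? v w = map′ (λ (d , s) → adjacent d (pointwise s)) (λ (adjacent d s) → d , at s)
    (¬? (fibre v ≟F fibre w) ×-dec all? (λ p → all? (λ q → _ ≈? _)))

  Adjacent-resp : ∀ {v v' w w'} → v ≈V v' → w ≈V w' → Adjacent v w → Adjacent v' w'
  Adjacent-resp (i≡i' ∣ x≈x') (j≡j' ∣ y≈y') (adjacent i≢j y≈x+ij) = adjacent
    (λ i'≡j' → i≢j (trans i≡i' (trans i'≡j' (sym j≡j'))))
    (≈C-trans (≈C-sym y≈y') (≈C-trans y≈x+ij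
      (⊕-cong x≈x' (≈C-reflexive (λ p q → cong₂ (λ i j → edge i j p q) i≡i' j≡j')))))

  Adjacent-sym : ∀ {v w} → Adjacent v w → Adjacent w v
  Adjacent-sym {v} {w} (adjacent i≢j y≈x+ij) = adjacent (i≢j ∘ sym) (≈C-sym back)
    where
      i j : Base
      i = fibre v
      j = fibre w
      back : chain w ⊕ edge j i ≈C chain v
      back = ≈C-trans (⊕-cong y≈x+ij (≈C-refl {edge j i}))
               (≈C-trans (⊕-assoc (chain v) (edge i j) (edge j i)) (⊕-trivial (chain v) _ (edge-reverse i j)))

  Γ : Graph n
  Γ = record
    { adj    = λ k l → does (adjacent? (decode k) (decode l))
    ; sym    = λ k l → does-⇔ (mk⇔ Adjacent-sym Adjacent-sym)
                               (adjacent? (decode k) (decode l)) (adjacent? (decode l) (decode k))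
    ; irrefl = λ k e → distinct (from-does (adjacent? (decode k) (decode k)) e) refl
    }

  edge⇒adjacent : ∀ {k l} → Edge Γ k l → Adjacent (decode k) (decode l)
  edge⇒adjacent {k} {l} = from-does (adjacent? (decode k) (decode l))

  adjacent⇒edge : ∀ {v w} → Adjacent v w → Edge Γ (encode v) (encode w)
  adjacent⇒edge {v} {w} a = dec-true (adjacent? (decode (encode v)) (decode (encode w)))
                                     (Adjacent-resp (≈V-sym (decode-encode v)) (≈V-sym (decode-encode w)) a)

  open FibredAutomorphisms Γ fibreOf public

  record CoverMap : Set where
    field
      map            : Vertex → Vertex
      base           : Base → Base
      map-cong       : ∀ {v w} → v ≈V w → map v ≈V map w
      map-adjacent   : ∀ {v w} → Adjacent v w → Adjacent (map v) (map w)
      fibre-map      : ∀ v → fibre (map v) ≡ base (fibre v)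
      base-injective : ∀ {i j} → base i ≡ base j → i ≡ j
  open CoverMap public

  ⟦_⟧ : CoverMap → Perm n
  ⟦ F ⟧ k = encode (map F (decode k))

  ⟦⟧-encode : ∀ F v → ⟦ F ⟧ (encode v) ≡ encode (map F v)
  ⟦⟧-encode F v = encode-cong (map-cong F (decode-encode v))

  ⟦⟧-encode-≈V : ∀ F v w → map F v ≈V w → ⟦ F ⟧ (encode v) ≡ encode w
  ⟦⟧-encode-≈V F v w Fv≈w = trans (⟦⟧-encode F v) (encode-cong {map F v} {w} Fv≈w)

  ⟦⟧-fibre : ∀ F k → fibreOf (⟦ F ⟧ k) ≡ base F (fibreOf k)
  ⟦⟧-fibre F k = trans (fibre-≡ (decode-encode (map F (decode k)))) (fibre-map F (decode k))

  record CoverAut : Set where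
    field
      forward backward : CoverMap
      left-inverse     : ∀ v → map backward (map forward v) ≈V v
      right-inverse    : ∀ v → map forward (map backward v) ≈V v
  open CoverAut public

  forward∈G : ∀ A → G ⟦ forward A ⟧
  forward∈G A =
      (⟦ B ⟧ , inverse F B (left-inverse A) , inverse B F (right-inverse A))
    , (λ k l → does-⇔ (mk⇔ (reflect k l) (preserve k l))
                        (adjacent? (decode (⟦ F ⟧ k)) (decode (⟦ F ⟧ l))) (adjacent? (decode k) (decode l)))
    , (λ k l → (λ e → trans (⟦⟧-fibre F k) (trans (cong (base F) e) (sym (⟦⟧-fibre F l))))
             , (λ e → base-injective F (trans (sym (⟦⟧-fibre F k)) (trans e (⟦⟧-fibre F l)))))
    where
      F B : CoverMap
      F = forward A
      B = backward A
      inverse : ∀ F F⁻¹ → (∀ v → map F⁻¹ (map F v) ≈V v) → ∀ k → ⟦ F⁻¹ ⟧ (⟦ F ⟧ k) ≡ k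
      inverse F F⁻¹ inv k =
        trans (encode-cong (≈V-trans (map-cong F⁻¹ (decode-encode (map F (decode k)))) (inv (decode k))))
              (encode-decode k)
      preserve : ∀ k l → Adjacent (decode k) (decode l) → Adjacent (decode (⟦ F ⟧ k)) (decode (⟦ F ⟧ l))
      preserve k l a = Adjacent-resp (≈V-sym (decode-encode _)) (≈V-sym (decode-encode _)) (map-adjacent F a)
      reflect : ∀ k l → Adjacent (decode (⟦ F ⟧ k)) (decode (⟦ F ⟧ l)) → Adjacent (decode k) (decode l)
      reflect k l a = Adjacent-resp (left-inverse A _) (left-inverse A _)
        (map-adjacent B (Adjacent-resp (decode-encode _) (decode-encode _) a))

  translation : ∀ c → IsCycle c → CoverMap
  translation c c-cyc = record
    { map            = λ v → vertex (fibre v) (chain v ⊕ c) (joins-⊕-cycle {x = chain v} {c} (joins v) c-cyc)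
    ; base           = id
    ; map-cong       = λ (e ∣ x≈y) → e ∣ ⊕-cong x≈y (≈C-refl {c})
    ; map-adjacent   = λ {v} {w} (adjacent i≢j y≈x+ij) → adjacent i≢j
        (≈C-trans (⊕-cong y≈x+ij (≈C-refl {c})) (⊕-right-comm (chain v) (edge (fibre v) (fibre w)) c))
    ; fibre-map      = λ v → refl
    ; base-injective = id
    }

  translationAut : ∀ c → IsCycle c → CoverAut
  translationAut c c-cyc = record
    { forward       = translation c c-cyc
    ; backward      = translation (r' · c) (isCycle-· r' {c} c-cyc)
    ; left-inverse  = λ v → refl ∣ ⊕-cancel (chain v) c
    ; right-inverse = λ v → refl ∣ ≈C-trans (⊕-right-comm (chain v) (r' · c) c) (⊕-cancel (chain v) c)
    }

  translation∈N : ∀ c (c-cyc : IsCycle c) → N ⟦ translation c c-cyc ⟧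
  translation∈N c c-cyc = forward∈G (translationAut c c-cyc) , ⟦⟧-fibre (translation c c-cyc)

  -- A permutation π of K_{m+1} lifts by relabelling the chain and prepending the
  -- edge from 0 to π 0, so that the chain again starts at 0.
  module Lift (π : Permutation′ (suc m)) where
    s t : Base → Base
    s = π ⟨$⟩ʳ_
    t = π ⟨$⟩ˡ_

    δ-t : ∀ p a → δ (t p) a ≡ δ p (s a)
    δ-t p a = δ-cong-⇔ (t p) a p (s a) (λ e → trans (sym (inverseʳ π)) (cong s e))
                                         (λ e → trans (cong t e) (inverseˡ π))

    edge-relabel : ∀ i j p q → edge i j (t p) (t q) ≡ edge (s i) (s j) p q
    edge-relabel i j p q = cong₂ _*_ (δ-t p i) (δ-t q j)

    relabel : Chain → Chain
    relabel x p q = x (t p) (t q)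

    relabel-cong : ∀ {x y} → x ≈C y → relabel x ≈C relabel y
    relabel-cong x≈y = pointwise λ p q → at x≈y (t p) (t q)

    liftChain : Chain → Chain
    liftChain x = relabel x ⊕ edge zero (s zero)

    liftChain-joins : ∀ {i x} → Joins i x → Joins (s i) (liftChain x)
    liftChain-joins {i} {x} x-joins p = begin
      ∂ (liftChain x) p
        ≡⟨ trans (∂-⊕ (relabel x) (edge zero (s zero)) p)
                 (cong₂ _+_ (sym (sum-permute (skew x (t p)) (flip π))) (∂-edge zero (s zero) p)) ⟩
      ∂ x (t p) + (δ p zero + r' * δ p (s zero))
        ≈⟨ +-cong (x-joins (t p)) ≈-refl ⟩
      (δ (t p) zero + r' * δ (t p) i) + (δ p zero + r' * δ p (s zero))
        ≡⟨ cong₂ (λ a b → a + r' * b + (δ p zero + r' * δ p (s zero))) (δ-t p zero) (δ-t p i) ⟩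
      (δ p (s zero) + r' * δ p (s i)) + (δ p zero + r' * δ p (s zero))
        ≡⟨ regroup (δ p (s zero)) (δ p (s i)) (δ p zero) r' ⟩
      (δ p zero + r' * δ p (s i)) + (δ p (s zero) + r' * δ p (s zero))
        ≈⟨ +-congˡ (δ p zero + r' * δ p (s i)) (x+r'x≈0 (δ p (s zero))) ⟩
      (δ p zero + r' * δ p (s i)) + 0
        ≡⟨ ℕ.+-identityʳ _ ⟩
      δ p zero + r' * δ p (s i) ∎
      where
        open ≈-Reasoning
        regroup : ∀ a b c r' → a + r' * b + (c + r' * a) ≡ (c + r' * b) + (a + r' * a)
        regroup = solve-∀

    s-injective : ∀ {i j} → s i ≡ s j → i ≡ j
    s-injective e = trans (sym (inverseˡ π)) (trans (cong t e) (inverseˡ π))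

    liftChain-⊕-edge : ∀ x i j → liftChain (x ⊕ edge i j) ≈C liftChain x ⊕ edge (s i) (s j)
    liftChain-⊕-edge x i j = ≈C-trans
      (≈C-reflexive (λ p q → cong (λ e → x (t p) (t q) + e + edge zero (s zero) p q) (edge-relabel i j p q)))
      (⊕-right-comm (relabel x) (edge (s i) (s j)) (edge zero (s zero)))

    lift : CoverMap
    lift = record
      { map            = λ v → vertex (s (fibre v)) (liftChain (chain v)) (liftChain-joins {x = chain v} (joins v))
      ; base           = s
      ; map-cong       = λ (e ∣ x≈y) → cong s e ∣ ⊕-cong (relabel-cong x≈y) (≈C-refl {edge zero (s zero)})
      ; map-adjacent   = λ {v} {w} (adjacent i≢j y≈x+ij) → adjacent (i≢j ∘ s-injective)
          (≈C-trans (⊕-cong (relabel-cong y≈x+ij) (≈C-refl {edge zero (s zero)}))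
                    (liftChain-⊕-edge (chain v) (fibre v) (fibre w)))
      ; fibre-map      = λ v → refl
      ; base-injective = s-injective
      }

  liftChain-flip : ∀ π x → Lift.liftChain (flip π) (Lift.liftChain π x) ≈C x
  liftChain-flip π x = ≈C-trans (≈C-reflexive unfold)
    (≈C-trans (⊕-assoc x _ _) (⊕-trivial x _ (edge-reverse (t zero) zero)))
    where
      open Lift π using (s; t)
      unfold : ∀ p q → Lift.liftChain (flip π) (Lift.liftChain π x) p q
                       ≡ (x ⊕ edge (t zero) zero ⊕ edge zero (t zero)) p q
      unfold p q = cong₂ (λ u e → u + e + edge zero (t zero) p q)
        (cong₂ x (inverseˡ π) (inverseˡ π))
        (trans (Lift.edge-relabel (flip π) zero (s zero) p q) (cong (λ j → edge (t zero) j p q) (inverseˡ π)))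

  liftAut : Permutation′ (suc m) → CoverAut
  liftAut π = record
    { forward       = Lift.lift π
    ; backward      = Lift.lift (flip π)
    ; left-inverse  = λ v → inverseˡ π ∣ liftChain-flip π (chain v)
    ; right-inverse = λ v → inverseʳ π ∣ liftChain-flip (flip π) (chain v)
    }

  α₀V : Vertex
  α₀V = vertex zero 0C (cycle⇒joins₀ {0C} 0C-isCycle)

  α₀ : Fin n
  α₀ = encode α₀V

  stepTo : Vertex → Base → Vertex
  stepTo v j = vertex j (chain v ⊕ edge (fibre v) j) (joins-⊕-edge {x = chain v} j (joins v))

  adjacent-stepTo : ∀ v j → fibre v ≢ j → Adjacent v (stepTo v j)
  adjacent-stepTo v j i≢j = adjacent i≢j ≈C-refl

  to-α₀ : ∀ k → ∃[ g ] (G g × g k ≡ α₀)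
  to-α₀ k = ⟦ T ⟧ ∘ ⟦ L ⟧ , G-∘ (forward∈G (translationAut c c-cyc)) (forward∈G (liftAut π)) , moved
    where
      vₖ : Vertex
      vₖ = decode k
      π : Permutation′ (suc m)
      π = transpose (fibre vₖ) zero
      L : CoverMap
      L = Lift.lift π
      w : Vertex
      w = map L vₖ
      w-fibre : fibre w ≡ zero
      w-fibre = transpose-matchˡ (fibre vₖ) zero
      c : Chain
      c = r' · chain w
      c-cyc : IsCycle c
      c-cyc = isCycle-· r' {chain w} (joins₀⇒cycle {chain w} (subst (λ i → Joins i (chain w)) w-fibre (joins w)))
      T : CoverMap
      T = translation c c-cyc
      moved : ⟦ T ⟧ (⟦ L ⟧ k) ≡ α₀
      moved = ⟦⟧-encode-≈V T w α₀V (w-fibre ∣ ⊕-cancel 0C (chain w))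

  neighbourV : Fin m → Vertex
  neighbourV j = stepTo α₀V (suc j)

  neighbour : Fin m → Fin n
  neighbour j = encode (neighbourV j)

  neighbour-injective : ∀ i j → neighbour i ≡ neighbour j → i ≡ j
  neighbour-injective i j e = suc-injective (fibre-≡ (encode-injective {neighbourV i} {neighbourV j} e))

  neighbour-edge : ∀ i → Edge Γ α₀ (neighbour i)
  neighbour-edge i = adjacent⇒edge (adjacent-stepTo α₀V (suc i) (λ ()))

  neighbour-onto : ∀ β → Edge Γ α₀ β → ∃[ j ] (neighbour j ≡ β)
  neighbour-onto β α₀β = over (fibre (decode β)) refl
    where
      a : Adjacent α₀V (decode β)
      a = Adjacent-resp (decode-encode α₀V) ≈V-refl (edge⇒adjacent α₀β)
      over : ∀ i → fibre (decode β) ≡ i → ∃[ j ] (neighbour j ≡ β)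
      over zero    e = ⊥-elim (distinct a (sym e))
      over (suc j) e = j , trans (encode-cong {neighbourV j} {decode β} (sym e ∣ ≈C-sym chain-β)) (encode-decode β)
        where
          chain-β : chain (decode β) ≈C 0C ⊕ edge zero (suc j)
          chain-β = ≈C-trans (extends a) (≈C-reflexive (λ p q → cong (λ i → edge zero i p q) e))

  neighbour-sym : ∀ (π : Permutation′ m) →
                  ∃[ g ] (G g × g α₀ ≡ α₀ × (∀ i → g (neighbour i) ≡ neighbour (π ⟨$⟩ʳ i)))
  neighbour-sym π = ⟦ L ⟧ , forward∈G (liftAut (lift₀ π))
                  , ⟦⟧-encode-≈V L α₀V α₀V (refl ∣ ⊕-loop 0C zero)
                  , λ i → ⟦⟧-encode-≈V L (neighbourV i) (neighbourV (π ⟨$⟩ʳ i)) (refl ∣ lifted i)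
    where
      L : CoverMap
      L = Lift.lift (lift₀ π)
      lifted : ∀ i → Lift.liftChain (lift₀ π) (0C ⊕ edge zero (suc i)) ≈C 0C ⊕ edge zero (suc (π ⟨$⟩ʳ i))
      lifted i = ≈C-trans (Lift.liftChain-⊕-edge (lift₀ π) 0C zero (suc i))
                          (⊕-cong (⊕-loop 0C zero) (≈C-refl {edge zero (suc (π ⟨$⟩ʳ i))}))

  locallySym : LocallySym m Γ G
  locallySym = LocalCriterion.locallySym G-isAutGroup α₀ to-α₀
                 neighbour neighbour-injective neighbour-onto neighbour-edge neighbour-sym

  twoArcTransitive : TwoArcTransitive Γ G
  twoArcTransitive = LocalCriterion.twoArcTransitive G-isAutGroup α₀ to-α₀
                       neighbour neighbour-injective neighbour-onto neighbour-edge neighbour-sym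

  over₀ : Chain → Fin n
  over₀ c = combine {suc m} {skewCount m} zero (encodeSkew (inner c))

  over₀-cong : ∀ {c c'} → c ≈C c' → over₀ c ≡ over₀ c'
  over₀-cong c≈c' = cong (combine {suc m} {skewCount m} zero) (encodeSkew-cong (λ a b → at c≈c' (suc a) (suc b)))

  ReachableCycle : Chain → Set
  ReachableCycle c = Reach Γ α₀ (over₀ c)

  reachable-resp : ∀ {c c'} → c ≈C c' → ReachableCycle c → ReachableCycle c'
  reachable-resp c≈c' = subst (Reach Γ α₀) (over₀-cong c≈c')

  -- Translating a walk from α₀ to c by the cycle d gives a walk from d to c ⊕ d.
  reachable-⊕ : ∀ {c d} → IsCycle c → IsCycle d → ReachableCycle c → ReachableCycle d → ReachableCycle (c ⊕ d)
  reachable-⊕ {c} {d} c-cyc d-cyc reach-c reach-d =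
    Reach-trans reach-d (subst₂ (Reach Γ) (⟦⟧-encode T α₀V) (⟦⟧-encode T (vertex zero c (cycle⇒joins₀ {c} c-cyc)))
                                 (Reach-map G-isAutGroup (forward∈G (translationAut d d-cyc)) reach-c))
    where
      T : CoverMap
      T = translation d d-cyc

  reachable-· : ∀ k {c} → IsCycle c → ReachableCycle c → ReachableCycle (k · c)
  reachable-· zero    c-cyc reach-c = here
  reachable-· (suc k) {c} c-cyc reach-c =
    reachable-⊕ {c} {k · c} c-cyc (isCycle-· k {c} c-cyc) reach-c (reachable-· k {c} c-cyc reach-c)

  ∑C : ∀ {k} → (Fin k → Chain) → Chain
  ∑C {zero}  f = 0C
  ∑C {suc k} f = f zero ⊕ ∑C (f ∘ suc)

  ∑C-apply : ∀ {k} (f : Fin k → Chain) p q → ∑C f p q ≡ sum (λ a → f a p q)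
  ∑C-apply {zero}  f p q = refl
  ∑C-apply {suc k} f p q = cong (f zero p q +_) (∑C-apply (f ∘ suc) p q)

  isCycle-∑C : ∀ {k} (f : Fin k → Chain) → (∀ a → IsCycle (f a)) → IsCycle (∑C f)
  isCycle-∑C {zero}  f f-cyc = 0C-isCycle
  isCycle-∑C {suc k} f f-cyc = isCycle-⊕ {f zero} {∑C (f ∘ suc)} (f-cyc zero) (isCycle-∑C (f ∘ suc) (f-cyc ∘ suc))

  reachable-∑C : ∀ {k} (f : Fin k → Chain) → (∀ a → IsCycle (f a)) → (∀ a → ReachableCycle (f a)) →
                 ReachableCycle (∑C f)
  reachable-∑C {zero}  f f-cyc reach-f = here
  reachable-∑C {suc k} f f-cyc reach-f =
    reachable-⊕ {f zero} {∑C (f ∘ suc)} (f-cyc zero) (isCycle-∑C (f ∘ suc) (f-cyc ∘ suc))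
                (reach-f zero) (reachable-∑C (f ∘ suc) (f-cyc ∘ suc) (reach-f ∘ suc))

  triangleWalk : Fin m → Fin m → Vertex
  triangleWalk a b = stepTo (stepTo (neighbourV a) (suc b)) zero

  triangle : Fin m → Fin m → Chain
  triangle a b = chain (triangleWalk a b)

  triangle-isCycle : ∀ a b → IsCycle (triangle a b)
  triangle-isCycle a b = joins₀⇒cycle {triangle a b} (joins (triangleWalk a b))

  triangle-inner : ∀ a b c d → triangle a b (suc c) (suc d) ≡ δ c a * δ d b
  triangle-inner a b c d = trans (cong (δ c a * δ d b +_) (ℕ.*-zeroʳ (δ c b))) (ℕ.+-identityʳ _)

  reachable-triangle : ∀ a b → ReachableCycle (triangle a b)
  reachable-triangle a b with a ≟F b
  ... | yes refl = reachable-resp (≈C-sym degenerate) here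
    where
      degenerate : triangle a a ≈C 0C
      degenerate = ≈C-trans (⊕-right-comm (0C ⊕ edge zero (suc a)) (edge (suc a) (suc a)) (edge (suc a) zero))
        (≈C-trans (⊕-trivial _ (edge (suc a) (suc a)) (edge-loop (suc a)))
        (≈C-trans (⊕-assoc 0C (edge zero (suc a)) (edge (suc a) zero))
                  (⊕-trivial 0C _ (edge-reverse zero (suc a)))))
  ... | no a≢b =
    step (adjacent⇒edge (adjacent-stepTo α₀V (suc a) (λ ())))
      (step (adjacent⇒edge (adjacent-stepTo (neighbourV a) (suc b) (a≢b ∘ suc-injective)))
        (step (adjacent⇒edge (adjacent-stepTo (stepTo (neighbourV a) (suc b)) zero (λ ()))) here))

  -- Every cycle is the combination of the triangles 0 → a → b → 0 with the
  -- coefficients of its inner block.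
  triangleExpansion : Chain → Chain
  triangleExpansion x = ∑C (λ a → ∑C (λ b → x (suc a) (suc b) · triangle a b))

  triangleExpansion-inner : ∀ x c d → triangleExpansion x (suc c) (suc d) ≡ x (suc c) (suc d)
  triangleExpansion-inner x c d = begin
      triangleExpansion x (suc c) (suc d)
        ≡⟨ ∑C-apply (λ a → ∑C (λ b → x (suc a) (suc b) · triangle a b)) (suc c) (suc d) ⟩
      sum (λ a → ∑C (λ b → x (suc a) (suc b) · triangle a b) (suc c) (suc d))
        ≡⟨ sum-cong-≗ (λ a → trans (∑C-apply (λ b → x (suc a) (suc b) · triangle a b) (suc c) (suc d))
                                   (sum-cong-≗ (λ b → cong (x (suc a) (suc b) *_) (triangle-inner a b c d)))) ⟩
      sum (λ a → sum (λ b → x (suc a) (suc b) * (δ c a * δ d b)))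
        ≡⟨ sum-cong-≗ (λ a → trans (sum-cong-≗ (λ b → reorder (x (suc a) (suc b)) (δ c a) (δ d b)))
                                   (sum-δ* (λ b → δ c a * x (suc a) (suc b)) d)) ⟩
      sum (λ a → δ c a * x (suc a) (suc d))
        ≡⟨ sum-δ* (λ a → x (suc a) (suc d)) c ⟩
      x (suc c) (suc d) ∎
    where
      open ≡-Reasoning
      reorder : ∀ u v w → u * (v * w) ≡ w * (v * u)
      reorder = solve-∀

  reachable-cycle : ∀ x → IsCycle x → ReachableCycle x
  reachable-cycle x x-cyc = reachable-resp expansion≈x (reachable-∑C rows row-cyc row-reachable)
    where
      terms : Fin m → Fin m → Chain
      terms a b = x (suc a) (suc b) · triangle a b
      rows : Fin m → Chain
      rows a = ∑C (terms a)
      term-cyc : ∀ a b → IsCycle (terms a b)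
      term-cyc a b = isCycle-· (x (suc a) (suc b)) {triangle a b} (triangle-isCycle a b)
      row-cyc : ∀ a → IsCycle (rows a)
      row-cyc a = isCycle-∑C (terms a) (term-cyc a)
      row-reachable : ∀ a → ReachableCycle (rows a)
      row-reachable a = reachable-∑C (terms a) (term-cyc a) λ b →
        reachable-· (x (suc a) (suc b)) {triangle a b} (triangle-isCycle a b) (reachable-triangle a b)
      inner-≈ : ∀ c d → inner (triangleExpansion x) c d ≈ inner x c d
      inner-≈ c d = ≈-reflexive
        (skew-≡ (triangleExpansion x) (triangleExpansion-inner x c d) (triangleExpansion-inner x d c))
      expansion≈x : triangleExpansion x ≈C x
      expansion≈x = ≈C-from-inner (cycle⇒joins₀ {triangleExpansion x} (isCycle-∑C rows row-cyc))
                                  (cycle⇒joins₀ {x} x-cyc) inner-≈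

  reachable-fibre₀ : ∀ v → fibre v ≡ zero → Reach Γ α₀ (encode v)
  reachable-fibre₀ v fibre≡0 =
    subst (Reach Γ α₀) (encode-cong {vertex zero (chain v) joins₀} {v} (sym fibre≡0 ∣ ≈C-refl))
          (reachable-cycle (chain v) (joins₀⇒cycle {chain v} joins₀))
    where
      joins₀ : Joins zero (chain v)
      joins₀ = subst (λ i → Joins i (chain v)) fibre≡0 (joins v)

  reachable-vertex : ∀ v → Reach Γ α₀ (encode v)
  reachable-vertex v with fibre v ≟F zero
  ... | yes fibre≡0 = reachable-fibre₀ v fibre≡0
  ... | no  fibre≢0 = Reach-snoc (reachable-fibre₀ (stepTo v zero) refl)
                                 (adjacent⇒edge (Adjacent-sym (adjacent-stepTo v zero fibre≢0)))

  reachable : ∀ k → Reach Γ α₀ k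
  reachable k = subst (Reach Γ α₀) (encode-decode k) (reachable-vertex (decode k))

  connected : Connected Γ
  connected = connected-from G-isAutGroup α₀ reachable

  fibreOf-neighbour : ∀ j → fibreOf (neighbour j) ≡ suc j
  fibreOf-neighbour j = fibre-≡ (decode-encode (neighbourV j))

  fibreOf-α₀ : fibreOf α₀ ≡ zero
  fibreOf-α₀ = fibre-≡ (decode-encode α₀V)

  sameOrbit⇒sameFibre : ∀ {x y} → SameOrbit N x y → fibreOf x ≡ fibreOf y
  sameOrbit⇒sameFibre {x} (h , (_ , h-fix) , hx≡y) = trans (sym (h-fix x)) (cong fibreOf hx≡y)

  sameFibre⇒sameOrbit : ∀ x y → fibreOf x ≡ fibreOf y → SameOrbit N x y
  sameFibre⇒sameOrbit x y same = ⟦ T ⟧ , translation∈N c c-cyc , moved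
    where
      vx vy : Vertex
      vx = decode x
      vy = decode y
      c : Chain
      c = chain vy ⊕ r' · chain vx
      c-cyc : IsCycle c
      c-cyc = joins-difference {fibre vy} {chain vx} {chain vy}
                (subst (λ i → Joins i (chain vx)) same (joins vx)) (joins vy)
      T : CoverMap
      T = translation c c-cyc
      moved : ⟦ T ⟧ x ≡ y
      moved = trans (encode-cong {map T vx} {vy} (same ∣ ⊕-difference (chain vx) (chain vy))) (encode-decode y)

  moreThanTwoOrbits : 3 ≤ m → MoreThanTwoOrbits N
  moreThanTwoOrbits (s≤s (s≤s (s≤s _))) =
      α₀ , neighbour zero , neighbour (suc zero)
    , (λ o → 0≢1+ (trans (sym fibreOf-α₀) (trans (sameOrbit⇒sameFibre o) (fibreOf-neighbour zero))))
    , (λ o → 0≢1+ (trans (sym fibreOf-α₀) (trans (sameOrbit⇒sameFibre o) (fibreOf-neighbour (suc zero)))))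
    , (λ o → 0≢1+ (suc-injective (trans (sym (fibreOf-neighbour zero))
                                         (trans (sameOrbit⇒sameFibre o) (fibreOf-neighbour (suc zero))))))
    where
      0≢1+ : ∀ {k} {j : Fin k} → zero ≢ suc j
      0≢1+ ()

  no-permutable-qMatching : 3 ≤ m → ¬ (Σ (QMatching m Γ N) λ M → QPermutable G M)
  no-permutable-qMatching 3≤m (M , _) =
    ℕ.<-irrefl refl (ℕ.≤-trans 2+m≤m+m (qMatching-size fibreOf sameFibre⇒sameOrbit M))
    where
      2+m≤m+m : suc (suc m) ≤ m + m
      2+m≤m+m = subst (_≤ m + m) (ℕ.+-comm m 2) (ℕ.+-monoʳ-≤ m (ℕ.<⇒≤ 3≤m))

  module _ (1≉0 : ¬ (1 ≈ 0)) where

    fan : Fin m → Chain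
    fan i = ∑C (triangle i)

    fan-isCycle : ∀ i → IsCycle (fan i)
    fan-isCycle i = isCycle-∑C (triangle i) (triangle-isCycle i)

    fan-inner : ∀ i c d → fan i (suc c) (suc d) ≡ δ c i
    fan-inner i c d = begin
      fan i (suc c) (suc d)              ≡⟨ ∑C-apply (triangle i) (suc c) (suc d) ⟩
      sum (λ a → triangle i a (suc c) (suc d)) ≡⟨ sum-cong-≗ (λ a → trans (triangle-inner i a c d)
                                                                        (cong (δ c i *_) (δ-sym d a))) ⟩
      sum (λ a → δ c i * δ a d)          ≡⟨ sum-scale (δ c i) (λ a → δ a d) ⟩
      δ c i * sum (λ a → δ a d)          ≡⟨ cong (δ c i *_) (sum-δ d) ⟩
      δ c i * 1                          ≡⟨ ℕ.*-identityʳ (δ c i) ⟩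
      δ c i                              ∎
      where open ≡-Reasoning

    fan-injective : 3 ≤ m → ∀ i j → fan i ≈C fan j → i ≡ j
    fan-injective 3≤m i j fan-i≈fan-j with i ≟F j | third-element 3≤m i j
    ... | yes i≡j | _ = i≡j
    ... | no  i≢j | a , a≢i , a≢j = ⊥-elim (1≉0 (begin
      1                             ≡⟨ cong suc (ℕ.*-zeroʳ r') ⟨
      1 + r' * 0                    ≡⟨ skew-≡ (fan i) (in-fan i i a (δ-refl i)) (in-fan i a i (δ-≢ a≢i)) ⟨
      skew (fan i) (suc i) (suc a)  ≈⟨ at fan-i≈fan-j (suc i) (suc a) ⟩
      skew (fan j) (suc i) (suc a)  ≡⟨ skew-≡ (fan j) (in-fan j i a (δ-≢ i≢j)) (in-fan j a i (δ-≢ a≢j)) ⟩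
      0 + r' * 0                    ≡⟨ ℕ.*-zeroʳ r' ⟩
      0                             ∎))
      where
        open ≈-Reasoning
        in-fan : ∀ k c d {b} → δ c k ≡ b → fan k (suc c) (suc d) ≡ b
        in-fan k c d = trans (fan-inner k c d)

    tailV headV : Fin m → Vertex
    tailV i = vertex zero (fan i) (cycle⇒joins₀ {fan i} (fan-isCycle i))
    headV i = stepTo (tailV i) (suc i)

    matching : 3 ≤ m → Matching m Γ
    matching 3≤m = record
      { u      = encode ∘ tailV
      ; v      = encode ∘ headV
      ; isEdge = λ i → adjacent⇒edge (adjacent-stepTo (tailV i) (suc i) (λ ()))
      ; uu     = λ i j e → fan-injective 3≤m i j (chain-≈ (encode-injective {tailV i} {tailV j} e))
      ; vv     = λ i j e → suc-injective (fibre-≡ (encode-injective {headV i} {headV j} e))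
      ; uv     = λ i j e → 0≢1+ (fibre-≡ (encode-injective {tailV i} {headV j} e))
      }
      where
        0≢1+ : ∀ {j : Fin m} → zero ≢ suc j
        0≢1+ ()

    relabel-fan : ∀ π i p q → Lift.relabel (lift₀ π) (fan i) p q ≡ fan (π ⟨$⟩ʳ i) p q
    relabel-fan π i p q = begin
      fan i (t p) (t q)                                 ≡⟨ ∑C-apply (triangle i) (t p) (t q) ⟩
      sum (λ a → triangle i a (t p) (t q))              ≡⟨ sum-cong-≗ relabel-triangle ⟩
      sum (λ a → triangle (π ⟨$⟩ʳ i) (π ⟨$⟩ʳ a) p q)   ≡⟨ sum-permute (λ a → triangle (π ⟨$⟩ʳ i) a p q) π ⟨
      sum (λ a → triangle (π ⟨$⟩ʳ i) a p q)            ≡⟨ ∑C-apply (triangle (π ⟨$⟩ʳ i)) p q ⟨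
      fan (π ⟨$⟩ʳ i) p q                                ∎
      where
        open ≡-Reasoning
        open Lift (lift₀ π) using (t; edge-relabel)
        relabel-triangle : ∀ a → triangle i a (t p) (t q) ≡ triangle (π ⟨$⟩ʳ i) (π ⟨$⟩ʳ a) p q
        relabel-triangle a =
          cong₂ _+_ (cong₂ _+_ (cong (0 +_) (edge-relabel zero (suc i) p q)) (edge-relabel (suc i) (suc a) p q))
                    (edge-relabel (suc a) zero p q)

    permutable : (3≤m : 3 ≤ m) → Permutable {Γ = Γ} G (matching 3≤m)
    permutable 3≤m π = ⟦ L ⟧ , forward∈G (liftAut (lift₀ π)) , λ i → inj₁ (tail↦tail i , head↦head i)
      where
        L : CoverMap
        L = Lift.lift (lift₀ π)
        fan↦fan : ∀ i → Lift.liftChain (lift₀ π) (fan i) ≈C fan (π ⟨$⟩ʳ i)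
        fan↦fan i = ≈C-trans (⊕-loop (Lift.relabel (lift₀ π) (fan i)) zero) (≈C-reflexive (relabel-fan π i))
        tail↦tail : ∀ i → ⟦ L ⟧ (encode (tailV i)) ≡ encode (tailV (π ⟨$⟩ʳ i))
        tail↦tail i = ⟦⟧-encode-≈V L (tailV i) (tailV (π ⟨$⟩ʳ i)) (refl ∣ fan↦fan i)
        head↦head : ∀ i → ⟦ L ⟧ (encode (headV i)) ≡ encode (headV (π ⟨$⟩ʳ i))
        head↦head i = ⟦⟧-encode-≈V L (headV i) (headV (π ⟨$⟩ʳ i)) (refl ∣
          ≈C-trans (Lift.liftChain-⊕-edge (lift₀ π) (fan i) zero (suc i))
                   (⊕-cong (fan↦fan i) (≈C-refl {edge zero (suc (π ⟨$⟩ʳ i))})))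

    nontrivial : 3 ≤ m → Nontrivial N
    nontrivial (s≤s (s≤s (s≤s _))) = ⟦ T ⟧ , translation∈N c c-cyc , α₀ , moves
      where
        c : Chain
        c = triangle zero (suc zero)
        c-cyc : IsCycle c
        c-cyc = triangle-isCycle zero (suc zero)
        T : CoverMap
        T = translation c c-cyc
        moves : ⟦ T ⟧ α₀ ≢ α₀
        moves e = 1≉0 (begin
          1                        ≡⟨ cong suc (ℕ.*-zeroʳ r') ⟨
          1 + r' * 0               ≡⟨ skew-≡ c {suc zero} {suc (suc zero)}
                                        (triangle-inner zero (suc zero) zero (suc zero))
                                        (triangle-inner zero (suc zero) (suc zero) zero) ⟨
          inner c zero (suc zero)  ≈⟨ at c≈0C (suc zero) (suc (suc zero)) ⟩
          inner 0C zero (suc zero) ≡⟨ skew-0C (suc zero) (suc (suc zero)) ⟩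
          0                        ∎)
          where
            open ≈-Reasoning
            c≈0C : 0C ⊕ c ≈C 0C
            c≈0C = chain-≈ (encode-injective {map T α₀V} {α₀V} (trans (sym (⟦⟧-encode T α₀V)) e))

corollary3p10 : ∀ (m : ℕ) → 3 ≤ m → ∀ (k : ℕ) →
    ∃[ n ] (k ≤ n × Σ (Graph n) λ Γ → Σ (Perm n → Set) λ G →
      IsAutGroup Γ G × Connected Γ ×
      TwoArcTransitive Γ G ×
      LocallySym m Γ G ×
      (Σ (Matching m Γ) λ M → Permutable G M) ×
      Σ (Perm n → Set) λ N →
        IsNormalSubgroup G N × Nontrivial N × MoreThanTwoOrbits N ×
        ¬ (Σ (QMatching m Γ N) λ M → QPermutable G M))
corollary3p10 m 3≤m k =
    n , k≤n , Γ , G , G-isAutGroup , connected , twoArcTransitive , locallySym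
  , (matching 1≉0 3≤m , permutable 1≉0 3≤m) , N , N-normal
  , nontrivial 1≉0 3≤m , moreThanTwoOrbits 3≤m , no-permutable-qMatching 3≤m
  where
    open HomologyCover m (suc k)
    1≉0 : ¬ (Modular._≈_ (suc k) 1 0)
    1≉0 = Modular.1≉0 (suc k) (s≤s (s≤s z≤n))
    k≤n : k ≤ n
    k≤n = ℕ.≤-trans (ℕ.≤-trans (ℕ.n≤1+n k) (ℕ.n≤1+n (suc k))) (r≤n (ℕ.<⇒≤ 3≤m))
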